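{- Let $n\ge0$ be an integer and let $\mathbf a,\mathbf b\in\{0,1\}^n\cup\{\pm1\}^n$. Then the following are equivalent: (i) $\mathbf a=\mathbf b$; (ii) $\mathcal T_{\mathbf a}$ and $\mathcal T_{\mathbf b}$ are isomorphic; (iii) $\mathsf E(\mathcal T_{\mathbf a},x,y)=\mathsf E(\mathcal T_{\mathbf b},x,y)$ and $\mathsf O(\mathcal T_{\mathbf a},x,y)=\mathsf O(\mathcal T_{\mathbf b},x,y)$; (iv) $\mathsf E(\mathcal T_{\mathbf a},x,y)=\mathsf E(\mathcal T_{\mathbf b},x,y)$.
   Context: A signed graph $\Sigma=(\Gamma,\sigma)$ is a finite simple graph $\Gamma$ with a signature $\sigma:E(\Gamma)\to\{\pm1\}$; signed graphs are isomorphic if some isomorphism of underlying graphs preserves all edge signs. For $\mathbf a=(a_1,\dots,a_n)\in\{ -1,0,1\}^n$, the signed threshold graph $\mathcal T_{\mathbf a}$ is built by starting from the one-vertex graph $K_1$ and, for $i=1,\dots,n$ in order, adding a new vertex that is isolated if $a_i=0$, joined by positive edges to all existing vertices if $a_i=1$, and joined by negative edges to all existing vertices if $a_i=-1$ (so $\mathcal T_{()}=K_1$). For a finite $C\subseteq\mathbb Z$, a proper $C$-colouring of $\Sigma$ is a map $\kappa:V(\Gamma)\to C$ with $\kappa(v)\ne\sigma(\{v,w\})\kappa(w)$ for every edge $\{v,w\}$. For integers $\lambda\ge\mu\ge0$, a finite $C\subseteq\mathbb Z$ is a $(\lambda,\mu)$-colour set if there are disjoint sets $P,U$ of nonzero integers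 with $-P=P$, $|U|=\mu$, $(-U)\cap U=\varnothing$, and either $\lambda-\mu$ even, $|P|=\lambda-\mu$, $C=P\cup U$, or $\lambda-\mu$ odd, $|P|=\lambda-\mu-1$, $C=P\cup U\cup\{0\}$. $f(\Sigma,\lambda,\mu)$ is the number of proper $C$-colourings for any $(\lambda,\mu)$-colour set $C$ (independent of $C$). $\mathsf E(\Sigma,x,y),\mathsf O(\Sigma,x,y)\in\mathbb Z[x,y]$ are the unique polynomials with $f(\Sigma,\lambda,\mu)=\mathsf E(\Sigma,\lambda,\mu)$ for all integers $\lambda\ge\mu\ge0$ with $\lambda-\mu$ even and $f(\Sigma,\lambda,\mu)=\mathsf O(\Sigma,\lambda,\mu)$ whenever $\lambda-\mu$ is odd. -}

module Defs where

open import Data.Nat as ℕ using (ℕ; zero; suc; _∸_; _≤_)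
open import Data.Nat.DivMod using (_/_; _%_)
open import Data.Integer as ℤ using (ℤ; +_; -_)
open import Data.Integer.Properties using () renaming (_≟_ to _≟ℤ_)
open import Data.Fin as Fin using (Fin; toℕ)
open import Data.Fin.Properties using () renaming (_<?_ to _<ᶠ?_)
open import Data.Vec as Vec using (Vec; []; _∷_; lookup)
open import Data.List as List using (List; []; _∷_; _++_; length; filterᵇ; concatMap; allFin; map)
open import Data.Bool.ListAction using (and)
open import Data.Bool using (Bool; true; false; not; if_then_else_; _∧_)
open import Relation.Nullary.Decidable using (⌊_⌋)
open import Relation.Binary.PropositionalEquality using (_≡_; _≢_)
open import Function.Bundles using (_⤖_; Bijection)
open import Data.Vec.Relation.Unary.All using (All)
open import Data.Sum using (_⊎_)

data Edge : Set where
  noEdge pos neg : Edge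

SignedGraph : ℕ → Set
SignedGraph m = Fin m → Fin m → Edge

record _≅_ {m m′ : ℕ} (Σ₁ : SignedGraph m) (Σ₂ : SignedGraph m′) : Set where
  field
    φ        : Fin m ⤖ Fin m′
    preserve : ∀ u v → Σ₂ (Bijection.to φ u) (Bijection.to φ v) ≡ Σ₁ u v

data Tri : Set where
  m1 z p1 : Tri

-- a ∈ {0,1}^n ∪ {±1}^n
Admissible : ∀ {n} → Vec Tri n → Set
Admissible a = All (_≢ m1) a ⊎ All (_≢ z) a

triEdge : Tri → Edge
triEdge m1 = neg
triEdge z  = noEdge
triEdge p1 = pos

-- Vertex 0 is the initial K₁; vertex (suc i) is the vertex added at step i+1
-- (according to a_{i+1} = lookup a i).  The edge between u < v is
-- determined by the later vertex v.
laterEdge : ∀ {n} → Vec Tri n → Fin (suc n) → Edge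
laterEdge a Fin.zero    = noEdge
laterEdge a (Fin.suc i) = triEdge (lookup a i)

T : ∀ {n} → Vec Tri n → SignedGraph (suc n)
T a u v with ⌊ u <ᶠ? v ⌋ | ⌊ v <ᶠ? u ⌋
... | true  | _     = laterEdge a v
... | false | true  = laterEdge a u
... | false | false = noEdge

properᵇ : ∀ {m} → SignedGraph m → Vec ℤ m → Bool
properᵇ {m} Σ κ = and (concatMap (λ v → map (λ w → ok (Σ v w) (lookup κ v) (lookup κ w)) (allFin m)) (allFin m))
  where
  ok : Edge → ℤ → ℤ → Bool
  ok noEdge _ _ = true
  ok pos c d = not ⌊ c ≟ℤ d ⌋
  ok neg c d = not ⌊ c ≟ℤ (- d) ⌋

allMaps : (m : ℕ) → List ℤ → List (Vec ℤ m)
allMaps zero    C = [] ∷ []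
allMaps (suc m) C = concatMap (λ c → map (c ∷_) (allMaps m C)) C

countColourings : ∀ {m} → SignedGraph m → List ℤ → ℕ
countColourings Σ C = length (filterᵇ (properᵇ Σ) (allMaps _ C))

range : ℕ → ℕ → List ℕ      -- range s t = s+1, …, s+t
range s zero    = []
range s (suc t) = suc s ∷ range (suc s) t

colourSet : ℕ → ℕ → List ℤ
colourSet λ′ μ = P ++ U ++ Z
  where
  k = (λ′ ∸ μ) / 2
  P = concatMap (λ i → + i ∷ - (+ i) ∷ []) (range 0 k)
  U = map +_ (range k μ)
  Z = if ⌊ (λ′ ∸ μ) % 2 ℕ.≟ 1 ⌋ then (+ 0 ∷ []) else []

-- f(Σ, λ, μ)  (meaningful for λ ≥ μ ≥ 0)
f : ∀ {m} → SignedGraph m → ℕ → ℕ → ℕ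
f Σ λ′ μ = countColourings Σ (colourSet λ′ μ)

-- Polynomials in ℤ[x,y]: a list (indexed by i) of lists (indexed by j)
-- of coefficients of x^i y^j; missing coefficients are 0.

Poly : Set
Poly = List (List ℤ)

nth : List ℤ → ℕ → ℤ
nth []       _       = + 0
nth (c ∷ cs) zero    = c
nth (c ∷ cs) (suc j) = nth cs j

row : Poly → ℕ → List ℤ
row []       _       = []
row (r ∷ rs) zero    = r
row (r ∷ rs) (suc i) = row rs i

coeff : Poly → ℕ → ℕ → ℤ
coeff p i j = nth (row p i) j

_≐_ : Poly → Poly → Set
p ≐ q = ∀ i j → coeff p i j ≡ coeff q i j

evalRow : List ℤ → ℤ → ℤ
evalRow []       y = + 0
evalRow (c ∷ cs) y = c ℤ.+ y ℤ.* evalRow cs y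

eval : Poly → ℤ → ℤ → ℤ
eval []       x y = + 0
eval (r ∷ rs) x y = evalRow r y ℤ.+ x ℤ.* eval rs x y

IsE : ∀ {m} → SignedGraph m → Poly → Set
IsE Σ p = ∀ λ′ μ → μ ≤ λ′ → (λ′ ∸ μ) % 2 ≡ 0 → eval p (+ λ′) (+ μ) ≡ + f Σ λ′ μ

IsO : ∀ {m} → SignedGraph m → Poly → Set
IsO Σ p = ∀ λ′ μ → μ ≤ λ′ → (λ′ ∸ μ) % 2 ≡ 1 → eval p (+ λ′) (+ μ) ≡ + f Σ λ′ μ

-- The proper colourings of a threshold graph can be counted vertex by vertex: the count depends
-- only on the number l of available colours and the number μ of them whose negative is not
-- available, giving a recursion `colourings a l μ` that is valid for every zero-free list of
-- distinct colours, in particular for the (λ,μ)-colour sets with λ − μ even. So E determines the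
-- counts on the lines μ = λ and λ = μ + 2. On μ = λ the count is the chromatic polynomial of the
-- positive part, built from the steps y ↦ y g(y) and y ↦ y g(y − 1); comparing two such
-- polynomials at y = 0 and at y = −1 recovers the positions of the entries 1. On λ = μ + 2 an
-- entry −1 makes the count strictly smaller than on μ = λ, which tells {0,1}ⁿ from {±1}ⁿ. For
-- isomorphism the same information is carried by the distribution of positive degrees and by the
-- presence of negative edges. Finally E and O are unique since a polynomial vanishing at all
-- lattice points above the diagonal with a fixed parity of λ − μ is zero.

{-# OPTIONS --safe #-}
module Submission where

open import Defs
open import Data.Bool using (Bool; true; false; not; if_then_else_; _∧_; _∨_)
open import Data.Bool.ListAction using (and)
open import Data.Bool.Properties
  using (∧-assoc; ∧-identityʳ; ∧-zeroʳ; ∧-inverseʳ; ∨-assoc; ∨-identityʳ; ∨-zeroʳ; ∨-inverseʳ; ∨-conicalˡ; ∨-conicalʳ)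
open import Data.Fin using (Fin; inject₁; fromℕ) renaming (zero to fzero; suc to fsuc)
open import Data.Fin.Properties using (toℕ-inject₁; toℕ-fromℕ; toℕ<n) renaming (_<?_ to _<ᶠ?_)
open import Data.Integer using (ℤ; +_; +0; +[1+_]; -[1+_]; 0ℤ; 1ℤ; -_)
import Data.Integer as ℤ
open import Data.Integer.Properties using (_≟_; neg-involutive; +-injective; -[1+-injective)
import Data.Integer.Properties as ℤ
open import Data.List using (List; []; _∷_; _++_; length; map; concatMap; filterᵇ; tabulate; allFin; drop)
open import Data.List.Properties using (map-tabulate; ++-identityʳ; length-++; length-map)
open import Data.Nat as ℕ using (ℕ; zero; suc; _≤_; _<_; z≤n; s≤s)
open import Data.Nat.DivMod using (_/_; _%_; m≡m%n+[m/n]*n; [m+kn]%n≡m%n; m<n⇒m%n≡m)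
import Data.Nat.Properties as ℕ
open import Algebra.Properties.CommutativeMonoid.Sum ℕ.+-0-commutativeMonoid
  using (sum; sum-permute; sum-cong-≗; sum-init-last)
open import Data.Product using (Σ-syntax; _×_; _,_; proj₁; proj₂)
open import Data.Sum using (_⊎_; inj₁; inj₂)
open import Data.Unit using (⊤; tt)
open import Data.Vec using (Vec; []; _∷_; _∷ʳ_; lookup; foldl′; initLast)
import Data.Vec as Vec
open import Data.Vec.Properties using (foldl-∷ʳ; map-∷ʳ; ∷-injective)
open import Data.Vec.Relation.Unary.All using (All; []; _∷_)
open import Data.Vec.Relation.Unary.All.Properties using (lookup⁺)
open import Data.Vec.Relation.Unary.Any using (Any; here; there; index)
open import Data.Vec.Relation.Unary.Any.Properties using (lookup-index)
open import Function using (_∘_; id; _⇔_; mk⇔)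
open import Function.Bundles using (_⤖_; Bijection)
open import Function.Construct.Identity using (⤖-id)
open import Function.Construct.Symmetry using (⤖-sym)
open import Function.Properties.Bijection using (⤖⇒↔)
open import Relation.Nullary using (Dec; ¬_; yes; no; contradiction)
open import Relation.Nullary.Decidable using (⌊_⌋; isYes≗does; dec-true; dec-false; does-⇔)
open import Relation.Binary.PropositionalEquality
  using (_≡_; _≢_; refl; sym; trans; cong; cong₂; subst; subst₂; module ≡-Reasoning)

private variable A B : Set

∷ʳ-induction : (P : ∀ {n} → Vec A n → Set) → P [] →
               (∀ {n} (xs : Vec A n) x → P xs → P (xs ∷ʳ x)) → ∀ {n} (xs : Vec A n) → P xs
∷ʳ-induction P base step {zero}  []  = base
∷ʳ-induction P base step {suc n} xs with initLast xs
... | ys , y , refl = step ys y (∷ʳ-induction P base step ys)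

⌊⌋-true : (a? : Dec A) → A → ⌊ a? ⌋ ≡ true
⌊⌋-true a? a = trans (isYes≗does a?) (dec-true a? a)

⌊⌋-false : (a? : Dec A) → ¬ A → ⌊ a? ⌋ ≡ false
⌊⌋-false a? ¬a = trans (isYes≗does a?) (dec-false a? ¬a)

⌊⌋-⇔ : A ⇔ B → (a? : Dec A) (b? : Dec B) → ⌊ a? ⌋ ≡ ⌊ b? ⌋
⌊⌋-⇔ A⇔B a? b? = trans (isYes≗does a?) (trans (does-⇔ A⇔B a? b?) (sym (isYes≗does b?)))

bool-ext : ∀ {b b′ : Bool} → (b ≡ true → b′ ≡ true) → (b′ ≡ true → b ≡ true) → b ≡ b′
bool-ext {true}          b⇒b′ _    = sym (b⇒b′ refl)
bool-ext {false} {false} _    _    = refl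
bool-ext {false} {true}  _    b′⇒b = b′⇒b refl

≟-sym : ∀ (c d : ℤ) → ⌊ c ≟ d ⌋ ≡ ⌊ d ≟ c ⌋
≟-sym c d = ⌊⌋-⇔ (mk⇔ sym sym) (c ≟ d) (d ≟ c)

module IntegerPolynomials where

  open import Data.Integer using (∣_∣; _+_; _*_; _-_)
  open import Data.Integer.Properties
    using (abs-*; ∣i∣≡0⇒i≡0; i-j≡0⇒i≡j; i*j≡0⇒i≡0∨j≡0; +-inverseʳ; +-identityˡ; +-identityʳ; *-zeroʳ; *-cancelˡ-≡)
  open import Data.Integer.Solver using (module +-*-Solver)
  open +-*-Solver using (solve; _:+_; _:*_; _:-_; :-_; _:=_; con)

  multiple-below-factor : ∀ {m L} k → m ≡ L ℕ.* k → m < L → m ≡ 0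
  multiple-below-factor {L = L} zero    m≡L*0 _   = trans m≡L*0 (ℕ.*-zeroʳ L)
  multiple-below-factor {L = L} (suc k) refl    m<L = contradiction (ℕ.m≤m*n L (suc k)) (ℕ.<⇒≱ m<L)

  heads-differ-by-multiple : ∀ A A′ L E E′ → A + L * E ≡ A′ + L * E′ → A - A′ ≡ L * (E′ - E)
  heads-differ-by-multiple A A′ L E E′ eq = begin
      A - A′                     ≡⟨ solve 4 (λ A A′ L E → A :- A′ := (A :+ L :* E) :- A′ :- L :* E) refl A A′ L E ⟩
      (A + L * E) - A′ - L * E   ≡⟨ cong (λ s → s - A′ - L * E) eq ⟩
      (A′ + L * E′) - A′ - L * E ≡⟨ solve 4 (λ A′ L E E′ → (A′ :+ L :* E′) :- A′ :- L :* E := L :* (E′ :- E))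
                                          refl A′ L E E′ ⟩
      L * (E′ - E)               ∎
    where
    open ≡-Reasoning

  -- A − A′ is a multiple of pt t for every t, and pt |A − A′| exceeds |A − A′|.
  heads-equal : (pt : ℕ → ℕ) → (∀ t → t < pt t) → ∀ {A A′} (E E′ : ℕ → ℤ) →
                (∀ t → A + + pt t * E t ≡ A′ + + pt t * E′ t) → A ≡ A′
  heads-equal pt t<pt {A} {A′} E E′ agree =
    i-j≡0⇒i≡j A A′ (∣i∣≡0⇒i≡0 (multiple-below-factor ∣ E′ t - E t ∣ ∣A-A′∣≡L*k (t<pt t)))
    where
    t = ∣ A - A′ ∣
    ∣A-A′∣≡L*k : t ≡ pt t ℕ.* ∣ E′ t - E t ∣
    ∣A-A′∣≡L*k = trans (cong ∣_∣ (heads-differ-by-multiple A A′ (+ pt t) (E t) (E′ t) (agree t))) (abs-* (+ pt t) _)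

  tails-equal : ∀ A {L} E E′ → 0 < L → A + + L * E ≡ A + + L * E′ → E ≡ E′
  tails-equal A {L} E E′ 0<L eq
    with i*j≡0⇒i≡0∨j≡0 (+ L) (trans (sym (heads-differ-by-multiple A A (+ L) E E′ eq)) (+-inverseʳ A))
  ... | inj₁ L≡0    = contradiction (cong ∣_∣ L≡0) (ℕ.>⇒≢ 0<L)
  ... | inj₂ E′-E≡0 = sym (i-j≡0⇒i≡j E′ E E′-E≡0)

  evalRow-split : ∀ p y → evalRow p y ≡ nth p 0 + y * evalRow (drop 1 p) y
  evalRow-split []      y = sym (trans (+-identityˡ (y * 0ℤ)) (*-zeroʳ y))
  evalRow-split (c ∷ p) y = refl

  nth-drop1 : ∀ p j → nth (drop 1 p) j ≡ nth p (suc j)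
  nth-drop1 []      j = refl
  nth-drop1 (c ∷ p) j = refl

  evalRow-injective : (pt : ℕ → ℕ) → (∀ t → t < pt t) → ∀ p q →
               (∀ t → evalRow p (+ pt t) ≡ evalRow q (+ pt t)) → ∀ j → nth p j ≡ nth q j
  evalRow-injective pt t<pt p q agree j = at j
    where
    split : ∀ t → nth p 0 + + pt t * evalRow (drop 1 p) (+ pt t) ≡ nth q 0 + + pt t * evalRow (drop 1 q) (+ pt t)
    split t = trans (sym (evalRow-split p _)) (trans (agree t) (evalRow-split q _))
    heads : nth p 0 ≡ nth q 0
    heads = heads-equal pt t<pt _ _ split
    tails : ∀ t → evalRow (drop 1 p) (+ pt t) ≡ evalRow (drop 1 q) (+ pt t)
    tails t = tails-equal (nth p 0) _ _ (ℕ.m<n⇒0<n (t<pt t)) (trans (split t) (cong (_+ _) (sym heads)))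
    at : ∀ j → nth p j ≡ nth q j
    at zero    = heads
    at (suc j) = trans (sym (nth-drop1 p j))
                       (trans (evalRow-injective pt t<pt (drop 1 p) (drop 1 q) tails j) (nth-drop1 q j))

  evalRow-from-parts : ∀ p q y → nth p 0 ≡ nth q 0 → evalRow (drop 1 p) y ≡ evalRow (drop 1 q) y →
                       evalRow p y ≡ evalRow q y
  evalRow-from-parts p q y heads tails =
    trans (evalRow-split p y) (trans (cong₂ (λ c r → c + y * r) heads tails) (sym (evalRow-split q y)))

  evalRow-cong : ∀ p q → (∀ j → nth p j ≡ nth q j) → ∀ y → evalRow p y ≡ evalRow q y
  evalRow-cong []      []      _    y = refl
  evalRow-cong []      (d ∷ q) same y = evalRow-from-parts [] (d ∷ q) y (same 0) (evalRow-cong [] q (same ∘ suc) y)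
  evalRow-cong (c ∷ p) []      same y = evalRow-from-parts (c ∷ p) [] y (same 0) (evalRow-cong p [] (same ∘ suc) y)
  evalRow-cong (c ∷ p) (d ∷ q) same y = evalRow-from-parts (c ∷ p) (d ∷ q) y (same 0) (evalRow-cong p q (same ∘ suc) y)

  evalRow-≡-from-positives : ∀ p q → (∀ t → evalRow p (+ suc t) ≡ evalRow q (+ suc t)) →
                             ∀ y → evalRow p y ≡ evalRow q y
  evalRow-≡-from-positives p q agree = evalRow-cong p q (evalRow-injective suc ℕ.n<1+n p q agree)

  columns : Poly → ℤ → List ℤ
  columns p y = map (λ r → evalRow r y) p

  eval-columns : ∀ p x y → eval p x y ≡ evalRow (columns p y) x
  eval-columns []      x y = refl
  eval-columns (r ∷ p) x y = cong (λ s → evalRow r y + x * s) (eval-columns p x y)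

  nth-columns : ∀ p i y → nth (columns p y) i ≡ evalRow (row p i) y
  nth-columns []      i       y = refl
  nth-columns (r ∷ p) zero    y = refl
  nth-columns (r ∷ p) (suc i) y = nth-columns p i y

  -- Evaluating in y first turns p into a polynomial in x whose coefficients are the rows of p
  -- evaluated at y, so uniqueness in two variables is uniqueness in one variable applied twice.
  eval-injective : (pt : ℕ → ℕ → ℕ) → (∀ μ t → t < pt μ t) → ∀ p q →
                 (∀ μ t → eval p (+ pt μ t) (+ suc μ) ≡ eval q (+ pt μ t) (+ suc μ)) → p ≐ q
  eval-injective pt t<pt p q agree i = evalRow-injective suc ℕ.n<1+n (row p i) (row q i) row-agrees
    where
    row-agrees : ∀ μ → evalRow (row p i) (+ suc μ) ≡ evalRow (row q i) (+ suc μ)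
    row-agrees μ = begin
        evalRow (row p i) y          ≡⟨ nth-columns p i y ⟨
        nth (columns p y) i          ≡⟨ evalRow-injective (pt μ) (t<pt μ) (columns p y) (columns q y) columns-agree i ⟩
        nth (columns q y) i          ≡⟨ nth-columns q i y ⟩
        evalRow (row q i) y          ∎
      where
      open ≡-Reasoning
      y = + suc μ
      columns-agree : ∀ t → evalRow (columns p y) (+ pt μ t) ≡ evalRow (columns q y) (+ pt μ t)
      columns-agree t = trans (sym (eval-columns p _ y)) (trans (agree μ t) (eval-columns q _ y))

  eval-cong : ∀ p q → p ≐ q → ∀ x y → eval p x y ≡ eval q x y
  eval-cong p q p≐q x y = begin
      eval p x y               ≡⟨ eval-columns p x y ⟩
      evalRow (columns p y) x  ≡⟨ evalRow-cong (columns p y) (columns q y) same-columns x ⟩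
      evalRow (columns q y) x  ≡⟨ eval-columns q x y ⟨
      eval q x y               ∎
    where
    open ≡-Reasoning
    same-columns : ∀ i → nth (columns p y) i ≡ nth (columns q y) i
    same-columns i = trans (nth-columns p i y)
      (trans (evalRow-cong (row p i) (row q i) (p≐q i) y) (sym (nth-columns q i y)))

  IsPolynomial : (ℤ → ℤ) → Set
  IsPolynomial g = Σ[ p ∈ List ℤ ] (∀ y → evalRow p y ≡ g y)

  polynomial-extension : ∀ {g h} → IsPolynomial g → IsPolynomial h →
                         (∀ l → g (+ suc l) ≡ h (+ suc l)) → ∀ y → g y ≡ h y
  polynomial-extension (p , p≡g) (q , q≡h) agree y =
    trans (sym (p≡g y)) (trans (evalRow-≡-from-positives p q agree′ y) (q≡h y))
    where
    agree′ : ∀ l → evalRow p (+ suc l) ≡ evalRow q (+ suc l)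
    agree′ l = trans (p≡g _) (trans (agree l) (sym (q≡h _)))

  infixl 6 _⊕_

  _⊕_ : List ℤ → List ℤ → List ℤ
  []      ⊕ q       = q
  (a ∷ p) ⊕ []      = a ∷ p
  (a ∷ p) ⊕ (b ∷ q) = (a + b) ∷ (p ⊕ q)

  evalRow-⊕ : ∀ p q y → evalRow (p ⊕ q) y ≡ evalRow p y + evalRow q y
  evalRow-⊕ []      q       y = sym (+-identityˡ _)
  evalRow-⊕ (a ∷ p) []      y = sym (+-identityʳ _)
  evalRow-⊕ (a ∷ p) (b ∷ q) y rewrite evalRow-⊕ p q y =
    solve 5 (λ a b y P Q → (a :+ b) :+ y :* (P :+ Q) := (a :+ y :* P) :+ (b :+ y :* Q))
            refl a b y (evalRow p y) (evalRow q y)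

  evalRow-neg : ∀ p y → evalRow (map -_ p) y ≡ - evalRow p y
  evalRow-neg []      y = refl
  evalRow-neg (a ∷ p) y rewrite evalRow-neg p y =
    solve 3 (λ a y P → :- a :+ y :* (:- P) := :- (a :+ y :* P)) refl a y (evalRow p y)

  shift : List ℤ → List ℤ
  shift []      = []
  shift (c ∷ p) = (c ∷ shift p) ⊕ map -_ (shift p)

  evalRow-shift : ∀ p y → evalRow (shift p) y ≡ evalRow p (y - 1ℤ)
  evalRow-shift []      y = refl
  evalRow-shift (c ∷ p) y
    rewrite evalRow-⊕ (c ∷ shift p) (map -_ (shift p)) y | evalRow-neg (shift p) y | evalRow-shift p y =
    solve 3 (λ c y S → (c :+ y :* S) :+ (:- S) := c :+ (y :- con 1ℤ) :* S) refl c y (evalRow p (y - 1ℤ))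

  IsPolynomial-shift : ∀ {g} → IsPolynomial g → IsPolynomial (λ y → g (y - 1ℤ))
  IsPolynomial-shift (p , p≡g) = shift p , λ y → trans (evalRow-shift p y) (p≡g _)

  IsPolynomial-times-y : ∀ {g} → IsPolynomial g → IsPolynomial (λ y → y * g y)
  IsPolynomial-times-y (p , p≡g) = (0ℤ ∷ p) , λ y → trans (+-identityˡ _) (cong (y *_) (p≡g y))

  -- χ s is the chromatic polynomial of the threshold graph with cone steps s (a vertex joined to all
  -- earlier ones for true, an isolated vertex for false).
  χStep : Bool → (ℤ → ℤ) → ℤ → ℤ
  χStep true  g y = y * g (y - 1ℤ)
  χStep false g y = y * g y

  χ : ∀ {n} → Vec Bool n → ℤ → ℤ
  χ = foldl′ (λ g b → χStep b g) (λ y → y)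

  χ-∷ʳ : ∀ {n} (s : Vec Bool n) b y → χ (s ∷ʳ b) y ≡ χStep b (χ s) y
  χ-∷ʳ s b y = cong (λ g → g y) (foldl-∷ʳ _ (λ g b → χStep b g) (λ y → y) b s)

  IsPolynomial-χStep : ∀ b {g} → IsPolynomial g → IsPolynomial (χStep b g)
  IsPolynomial-χStep true  poly = IsPolynomial-times-y (IsPolynomial-shift poly)
  IsPolynomial-χStep false poly = IsPolynomial-times-y poly

  IsPolynomial-χ : ∀ {n} (s : Vec Bool n) → IsPolynomial (χ s)
  IsPolynomial-χ = ∷ʳ-induction (λ s → IsPolynomial (χ s)) ((0ℤ ∷ 1ℤ ∷ []) , identity) step
    where
    identity : ∀ y → evalRow (0ℤ ∷ 1ℤ ∷ []) y ≡ y
    identity = solve 1 (λ y → con 0ℤ :+ y :* (con 1ℤ :+ y :* con 0ℤ) := y) refl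
    step : ∀ {n} (s : Vec Bool n) b → IsPolynomial (χ s) → IsPolynomial (χ (s ∷ʳ b))
    step s b poly with IsPolynomial-χStep b poly
    ... | p , p≡χStep = p , λ y → trans (p≡χStep y) (sym (χ-∷ʳ s b y))

  χ-at-0 : ∀ {n} (s : Vec Bool n) → χ s 0ℤ ≡ 0ℤ
  χ-at-0 = ∷ʳ-induction (λ s → χ s 0ℤ ≡ 0ℤ) refl (λ s b _ → trans (χ-∷ʳ s b 0ℤ) (at-0 b))
    where
    at-0 : ∀ b {g} → χStep b g 0ℤ ≡ 0ℤ
    at-0 true  = refl
    at-0 false = refl

  χ-at-negative : ∀ {n} (s : Vec Bool n) j → χ s -[1+ j ] ≢ 0ℤ
  χ-at-negative = ∷ʳ-induction (λ s → ∀ j → χ s -[1+ j ] ≢ 0ℤ) (λ j ()) step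
    where
    step : ∀ {n} (s : Vec Bool n) b → (∀ j → χ s -[1+ j ] ≢ 0ℤ) → ∀ j → χ (s ∷ʳ b) -[1+ j ] ≢ 0ℤ
    step s false nonzero j eq with i*j≡0⇒i≡0∨j≡0 -[1+ j ] (trans (sym (χ-∷ʳ s false _)) eq)
    ... | inj₂ χ≡0 = nonzero j χ≡0
    step s true  nonzero j eq with i*j≡0⇒i≡0∨j≡0 -[1+ j ] (trans (sym (χ-∷ʳ s true _)) eq)
    ... | inj₂ χ≡0 = nonzero _ χ≡0

  -- Agreement at positive integers extends to all of ℤ; comparing the last steps at y = 0 then
  -- separates a cone step from an isolated one, since χ vanishes at 0 but not at negative integers.
  χ-injective : ∀ {n} (s t : Vec Bool n) → (∀ l → χ s (+ suc l) ≡ χ t (+ suc l)) → s ≡ t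
  χ-injective = ∷ʳ-induction Injective (λ { [] _ → refl }) step
    where
    Injective : ∀ {n} → Vec Bool n → Set
    Injective {n} s = ∀ (t : Vec Bool n) → (∀ l → χ s (+ suc l) ≡ χ t (+ suc l)) → s ≡ t
    step : ∀ {n} (s : Vec Bool n) b → Injective s → Injective (s ∷ʳ b)
    step s b IH t agree with initLast t
    ... | t′ , b′ , refl = last-step b b′ (λ l → trans (sym (χ-∷ʳ s b _)) (trans (agree l) (χ-∷ʳ t′ b′ _)))
      where
      last-step : ∀ b b′ → (∀ l → χStep b (χ s) (+ suc l) ≡ χStep b′ (χ t′) (+ suc l)) → s ∷ʳ b ≡ t′ ∷ʳ b′
      last-step false false agree′ = cong (_∷ʳ false) (IH t′ λ l → *-cancelˡ-≡ (+ suc l) _ _ (agree′ l))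
      last-step true  true  agree′ = cong (_∷ʳ true) (IH t′ λ l → *-cancelˡ-≡ (+ suc (suc l)) _ _ (agree′ (suc l)))
      last-step false true  agree′ = contradiction (trans (sym (shifted 0ℤ)) (χ-at-0 s)) (χ-at-negative t′ 0)
        where
        shifted : ∀ y → χ s y ≡ χ t′ (y - 1ℤ)
        shifted = polynomial-extension (IsPolynomial-χ s) (IsPolynomial-shift (IsPolynomial-χ t′))
                    (λ l → *-cancelˡ-≡ (+ suc l) _ _ (agree′ l))
      last-step true  false agree′ = contradiction (trans (shifted 0ℤ) (χ-at-0 t′)) (χ-at-negative s 0)
        where
        shifted : ∀ y → χ s (y - 1ℤ) ≡ χ t′ y
        shifted = polynomial-extension (IsPolynomial-shift (IsPolynomial-χ s)) (IsPolynomial-χ t′)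
                    (λ l → *-cancelˡ-≡ (+ suc l) _ _ (agree′ l))

open IntegerPolynomials

-- The arithmetic operators of ℤ are opened only inside IntegerPolynomials; from here on they are
-- those of ℕ.
open import Data.Nat using (_+_; _*_; _∸_)
open import Data.Nat.Solver using (module +-*-Solver)
open +-*-Solver using (solve; _:+_; _:=_)

𝟙 : Bool → ℕ
𝟙 true  = 1
𝟙 false = 0

countᵇ : (A → Bool) → List A → ℕ
countᵇ p []       = 0
countᵇ p (x ∷ xs) = 𝟙 (p x) + countᵇ p xs

sumOver : List A → (A → ℕ) → ℕ
sumOver []       g = 0
sumOver (x ∷ xs) g = g x + sumOver xs g

syntax sumOver xs (λ x → e) = ∑[ x ∈ xs ] e

length-filterᵇ : (p : A → Bool) (xs : List A) → length (filterᵇ p xs) ≡ countᵇ p xs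
length-filterᵇ p [] = refl
length-filterᵇ p (x ∷ xs) with p x
... | true  = cong suc (length-filterᵇ p xs)
... | false = length-filterᵇ p xs

countᵇ-cong : {p q : A → Bool} → (∀ x → p x ≡ q x) → ∀ xs → countᵇ p xs ≡ countᵇ q xs
countᵇ-cong p≗q []       = refl
countᵇ-cong p≗q (x ∷ xs) = cong₂ _+_ (cong 𝟙 (p≗q x)) (countᵇ-cong p≗q xs)

countᵇ-false : {p : A → Bool} → (∀ x → p x ≡ false) → ∀ xs → countᵇ p xs ≡ 0
countᵇ-false p≡false []       = refl
countᵇ-false p≡false (x ∷ xs) rewrite p≡false x = countᵇ-false p≡false xs

countᵇ-true : ∀ xs → countᵇ (λ (_ : A) → true) xs ≡ length xs
countᵇ-true []       = refl
countᵇ-true (x ∷ xs) = cong suc (countᵇ-true xs)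

countᵇ-++ : (p : A → Bool) (xs ys : List A) → countᵇ p (xs ++ ys) ≡ countᵇ p xs + countᵇ p ys
countᵇ-++ p []       ys = refl
countᵇ-++ p (x ∷ xs) ys = trans (cong (_+_ (𝟙 (p x))) (countᵇ-++ p xs ys)) (sym (ℕ.+-assoc (𝟙 (p x)) _ _))

countᵇ-map : (p : B → Bool) (g : A → B) (xs : List A) → countᵇ p (map g xs) ≡ countᵇ (λ x → p (g x)) xs
countᵇ-map p g []       = refl
countᵇ-map p g (x ∷ xs) = cong (_+_ (𝟙 (p (g x)))) (countᵇ-map p g xs)

countᵇ-concatMap : (p : B → Bool) (g : A → List B) (xs : List A) →
                   countᵇ p (concatMap g xs) ≡ ∑[ x ∈ xs ] countᵇ p (g x)
countᵇ-concatMap p g []       = refl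
countᵇ-concatMap p g (x ∷ xs) =
  trans (countᵇ-++ p (g x) (concatMap g xs)) (cong (_+_ (countᵇ p (g x))) (countᵇ-concatMap p g xs))

countᵇ-filterᵇ : (p q : A → Bool) (xs : List A) → countᵇ p (filterᵇ q xs) ≡ countᵇ (λ x → q x ∧ p x) xs
countᵇ-filterᵇ p q [] = refl
countᵇ-filterᵇ p q (x ∷ xs) with q x
... | true  = cong (_+_ (𝟙 (p x))) (countᵇ-filterᵇ p q xs)
... | false = countᵇ-filterᵇ p q xs

countᵇ-∨ : (p q : A → Bool) → (∀ x → p x ∧ q x ≡ false) →
           ∀ xs → countᵇ (λ x → p x ∨ q x) xs ≡ countᵇ p xs + countᵇ q xs
countᵇ-∨ p q disjoint []       = refl
countᵇ-∨ p q disjoint (x ∷ xs) = begin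
    𝟙 (p x ∨ q x) + countᵇ (λ x → p x ∨ q x) xs
  ≡⟨ cong₂ _+_ (𝟙-∨ (p x) (q x) (disjoint x)) (countᵇ-∨ p q disjoint xs) ⟩
    (𝟙 (p x) + 𝟙 (q x)) + (countᵇ p xs + countᵇ q xs)
  ≡⟨ solve 4 (λ a b c d → (a :+ b) :+ (c :+ d) := (a :+ c) :+ (b :+ d)) refl (𝟙 (p x)) (𝟙 (q x)) _ _ ⟩
    (𝟙 (p x) + countᵇ p xs) + (𝟙 (q x) + countᵇ q xs)
  ∎
  where
  open ≡-Reasoning
  𝟙-∨ : ∀ a b → a ∧ b ≡ false → 𝟙 (a ∨ b) ≡ 𝟙 a + 𝟙 b
  𝟙-∨ true  false _ = refl
  𝟙-∨ false b     _ = refl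

countᵇ-+-countᵇ-not : (p : A → Bool) (xs : List A) → countᵇ p xs + countᵇ (λ x → not (p x)) xs ≡ length xs
countᵇ-+-countᵇ-not p xs = begin
    countᵇ p xs + countᵇ (λ x → not (p x)) xs ≡⟨ countᵇ-∨ p _ (λ x → ∧-inverseʳ (p x)) xs ⟨
    countᵇ (λ x → p x ∨ not (p x)) xs          ≡⟨ countᵇ-cong (λ x → ∨-inverseʳ (p x)) xs ⟩
    countᵇ (λ _ → true) xs                     ≡⟨ countᵇ-true xs ⟩
    length xs                                  ∎
  where open ≡-Reasoning

∑-cong : {g h : A → ℕ} → (∀ x → g x ≡ h x) → ∀ xs → ∑[ x ∈ xs ] g x ≡ ∑[ x ∈ xs ] h x
∑-cong g≗h []       = refl
∑-cong g≗h (x ∷ xs) = cong₂ _+_ (g≗h x) (∑-cong g≗h xs)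

∑-const : (c : ℕ) (xs : List A) → ∑[ x ∈ xs ] c ≡ length xs * c
∑-const c []       = refl
∑-const c (x ∷ xs) = cong (_+_ c) (∑-const c xs)

∑-+ : (g h : A → ℕ) (xs : List A) → ∑[ x ∈ xs ] g x + ∑[ x ∈ xs ] h x ≡ ∑[ x ∈ xs ] (g x + h x)
∑-+ g h []       = refl
∑-+ g h (x ∷ xs) = begin
    (g x + ∑[ x ∈ xs ] g x) + (h x + ∑[ x ∈ xs ] h x)
  ≡⟨ solve 4 (λ a b c d → (a :+ b) :+ (c :+ d) := (a :+ c) :+ (b :+ d)) refl (g x) _ (h x) _ ⟩
    (g x + h x) + (∑[ x ∈ xs ] g x + ∑[ x ∈ xs ] h x)
  ≡⟨ cong (_+_ (g x + h x)) (∑-+ g h xs) ⟩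
    (g x + h x) + ∑[ x ∈ xs ] (g x + h x)
  ∎
  where open ≡-Reasoning

∑-swap : (F : A → B → ℕ) (xs : List A) (ys : List B) →
         ∑[ x ∈ xs ] ∑[ y ∈ ys ] F x y ≡ ∑[ y ∈ ys ] ∑[ x ∈ xs ] F x y
∑-swap F []       ys = trans (sym (ℕ.*-zeroʳ (length ys))) (sym (∑-const 0 ys))
∑-swap F (x ∷ xs) ys =
  trans (cong (_+_ (∑[ y ∈ ys ] F x y)) (∑-swap F xs ys)) (∑-+ (F x) (λ y → ∑[ x ∈ xs ] F x y) ys)

∑-filterᵇ : (g : A → ℕ) (q : A → Bool) (xs : List A) →
            ∑[ x ∈ filterᵇ q xs ] g x ≡ ∑[ x ∈ xs ] (if q x then g x else 0)
∑-filterᵇ g q [] = refl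
∑-filterᵇ g q (x ∷ xs) with q x
... | true  = cong (_+_ (g x)) (∑-filterᵇ g q xs)
... | false = ∑-filterᵇ g q xs

∑-if : (q : A → Bool) (m n : ℕ) (xs : List A) →
       ∑[ x ∈ xs ] (if q x then m else n) ≡ countᵇ q xs * m + countᵇ (λ x → not (q x)) xs * n
∑-if q m n [] = refl
∑-if q m n (x ∷ xs) with q x
... | true  = trans (cong (_+_ m) (∑-if q m n xs)) (sym (ℕ.+-assoc m _ _))
... | false = trans (cong (_+_ n) (∑-if q m n xs))
                    (solve 3 (λ n a b → n :+ (a :+ b) := a :+ (n :+ b)) refl n (countᵇ q xs * m) _)

infix 7 _≢ᵇ_

_≢ᵇ_ : ℤ → ℤ → Bool
c ≢ᵇ d = not ⌊ c ≟ d ⌋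

countMaps : (m : ℕ) → (Vec ℤ m → Bool) → List ℤ → ℕ
countMaps m P C = countᵇ P (allMaps m C)

countMaps-cong : ∀ m {P Q : Vec ℤ m → Bool} → (∀ κ → P κ ≡ Q κ) → ∀ C → countMaps m P C ≡ countMaps m Q C
countMaps-cong m P≗Q C = countᵇ-cong P≗Q (allMaps m C)

countMaps-∷ : ∀ m (P : Vec ℤ (suc m) → Bool) C →
              countMaps (suc m) P C ≡ ∑[ c ∈ C ] countMaps m (λ κ → P (c ∷ κ)) C
countMaps-∷ m P C = trans (countᵇ-concatMap P (λ c → map (c ∷_) (allMaps m C)) C)
                          (∑-cong (λ c → countᵇ-map P (c ∷_) (allMaps m C)) C)

countMaps-∷ʳ : ∀ m (P : Vec ℤ (suc m) → Bool) C →
               countMaps (suc m) P C ≡ ∑[ c ∈ C ] countMaps m (λ κ → P (κ ∷ʳ c)) C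
countMaps-∷ʳ zero    P C = countMaps-∷ zero P C
countMaps-∷ʳ (suc m) P C = begin
    countMaps (suc (suc m)) P C
  ≡⟨ countMaps-∷ (suc m) P C ⟩
    ∑[ d ∈ C ] countMaps (suc m) (λ κ → P (d ∷ κ)) C
  ≡⟨ ∑-cong (λ d → countMaps-∷ʳ m (λ κ → P (d ∷ κ)) C) C ⟩
    ∑[ d ∈ C ] ∑[ c ∈ C ] countMaps m (λ κ → P (d ∷ (κ ∷ʳ c))) C
  ≡⟨ ∑-swap (λ d c → countMaps m (λ κ → P (d ∷ (κ ∷ʳ c))) C) C C ⟩
    ∑[ c ∈ C ] ∑[ d ∈ C ] countMaps m (λ κ → P (d ∷ (κ ∷ʳ c))) C
  ≡⟨ ∑-cong (λ c → countMaps-∷ m (λ κ → P (κ ∷ʳ c)) C) C ⟨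
    ∑[ c ∈ C ] countMaps (suc m) (λ κ → P (κ ∷ʳ c)) C
  ∎
  where open ≡-Reasoning

avoids : ∀ {m} → ℤ → Vec ℤ m → Bool
avoids d []      = true
avoids d (c ∷ κ) = c ≢ᵇ d ∧ avoids d κ

remove : ℤ → List ℤ → List ℤ
remove d = filterᵇ (_≢ᵇ d)

countMaps-avoids : ∀ m (P : Vec ℤ m → Bool) d C →
                   countMaps m (λ κ → P κ ∧ avoids d κ) C ≡ countMaps m P (remove d C)
countMaps-avoids zero    P d C = cong (λ b → 𝟙 b + 0) (∧-identityʳ (P []))
countMaps-avoids (suc m) P d C = begin
    countMaps (suc m) (λ κ → P κ ∧ avoids d κ) C
  ≡⟨ countMaps-∷ m _ C ⟩
    ∑[ c ∈ C ] countMaps m (λ κ → P (c ∷ κ) ∧ (c ≢ᵇ d ∧ avoids d κ)) C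
  ≡⟨ ∑-cong first-colour C ⟩
    ∑[ c ∈ C ] (if c ≢ᵇ d then countMaps m (λ κ → P (c ∷ κ)) (remove d C) else 0)
  ≡⟨ ∑-filterᵇ _ (_≢ᵇ d) C ⟨
    ∑[ c ∈ remove d C ] countMaps m (λ κ → P (c ∷ κ)) (remove d C)
  ≡⟨ countMaps-∷ m P (remove d C) ⟨
    countMaps (suc m) P (remove d C)
  ∎
  where
  open ≡-Reasoning
  first-colour : ∀ c → countMaps m (λ κ → P (c ∷ κ) ∧ (c ≢ᵇ d ∧ avoids d κ)) C
                     ≡ (if c ≢ᵇ d then countMaps m (λ κ → P (c ∷ κ)) (remove d C) else 0)
  first-colour c with c ≟ d
  ... | yes _ = countᵇ-false (λ κ → ∧-zeroʳ (P (c ∷ κ))) (allMaps m C)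
  ... | no  _ = countMaps-avoids m (λ κ → P (c ∷ κ)) d C

andᶠ : ∀ {m} → (Fin m → Bool) → Bool
andᶠ {zero}  h = true
andᶠ {suc m} h = h fzero ∧ andᶠ (h ∘ fsuc)

andᶠ-cong : ∀ {m} {g h : Fin m → Bool} → (∀ i → g i ≡ h i) → andᶠ g ≡ andᶠ h
andᶠ-cong {zero}  g≗h = refl
andᶠ-cong {suc m} g≗h = cong₂ _∧_ (g≗h fzero) (andᶠ-cong (g≗h ∘ fsuc))

andᶠ-intro : ∀ {m} (h : Fin m → Bool) → (∀ i → h i ≡ true) → andᶠ h ≡ true
andᶠ-intro {zero}  h _   = refl
andᶠ-intro {suc m} h all rewrite all fzero = andᶠ-intro (h ∘ fsuc) (all ∘ fsuc)

andᶠ-elim : ∀ {m} (h : Fin m → Bool) → andᶠ h ≡ true → ∀ i → h i ≡ true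
andᶠ-elim {suc m} h eq i with h fzero in h0
andᶠ-elim {suc m} h eq fzero    | true = h0
andᶠ-elim {suc m} h eq (fsuc i) | true = andᶠ-elim (h ∘ fsuc) eq i

andᶠ-false : ∀ {m} (h : Fin m → Bool) → andᶠ h ≡ false → Σ[ i ∈ Fin m ] h i ≡ false
andᶠ-false {suc m} h eq with h fzero in h0
... | false = fzero , h0
... | true  with andᶠ-false (h ∘ fsuc) eq
...   | i , hi = fsuc i , hi

andᶠ-true : ∀ {m} → andᶠ {m} (λ _ → true) ≡ true
andᶠ-true {m} = andᶠ-intro {m} _ (λ _ → refl)

andᶠ-∧ : ∀ {m} (g h : Fin m → Bool) → andᶠ (λ i → g i ∧ h i) ≡ andᶠ g ∧ andᶠ h
andᶠ-∧ {zero}  g h = refl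
andᶠ-∧ {suc m} g h =
  trans (cong ((g fzero ∧ h fzero) ∧_) (andᶠ-∧ (g ∘ fsuc) (h ∘ fsuc))) (interchange (g fzero) (h fzero) _ _)
  where
  interchange : ∀ a b c d → (a ∧ b) ∧ (c ∧ d) ≡ (a ∧ c) ∧ (b ∧ d)
  interchange true  true  c d = refl
  interchange true  false c d = sym (∧-zeroʳ c)
  interchange false b     c d = refl

andᶠ-last : ∀ {m} (h : Fin (suc m) → Bool) → andᶠ h ≡ andᶠ (h ∘ inject₁) ∧ h (fromℕ m)
andᶠ-last {zero}  h = ∧-identityʳ (h fzero)
andᶠ-last {suc m} h = trans (cong (h fzero ∧_) (andᶠ-last (h ∘ fsuc))) (sym (∧-assoc (h fzero) _ _))

and-++ : (bs cs : List Bool) → and (bs ++ cs) ≡ and bs ∧ and cs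
and-++ []       cs = refl
and-++ (b ∷ bs) cs = trans (cong (b ∧_) (and-++ bs cs)) (sym (∧-assoc b _ _))

and-tabulate : ∀ {m} (h : Fin m → Bool) → and (tabulate h) ≡ andᶠ h
and-tabulate {zero}  h = refl
and-tabulate {suc m} h = cong (h fzero ∧_) (and-tabulate (h ∘ fsuc))

and-allPairs : ∀ {m} (F : Fin m → Fin m → Bool) →
               and (concatMap (λ v → map (F v) (allFin m)) (allFin m)) ≡ andᶠ (λ v → andᶠ (F v))
and-allPairs {m} F = trans (and-concatMap (λ v → map (F v) (allFin m)) id) (andᶠ-cong and-row)
  where
  and-concatMap : ∀ {k} (G : A → List Bool) (e : Fin k → A) →
                  and (concatMap G (tabulate e)) ≡ andᶠ (λ i → and (G (e i)))
  and-concatMap {k = zero}  G e = refl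
  and-concatMap {k = suc k} G e =
    trans (and-++ (G (e fzero)) _) (cong (and (G (e fzero)) ∧_) (and-concatMap G (e ∘ fsuc)))
  and-row : ∀ v → and (map (F v) (allFin m)) ≡ andᶠ (F v)
  and-row v = trans (cong and (map-tabulate id (F v))) (and-tabulate (F v))

compatible : Edge → ℤ → ℤ → Bool
compatible noEdge c d = true
compatible pos    c d = c ≢ᵇ d
compatible neg    c d = c ≢ᵇ (- d)

compatible-sym : ∀ e c d → compatible e c d ≡ compatible e d c
compatible-sym noEdge c d = refl
compatible-sym pos    c d = cong not (≟-sym c d)
compatible-sym neg    c d = cong not (⌊⌋-⇔ (mk⇔ swap swap) (c ≟ - d) (d ≟ - c))
  where
  swap : ∀ {i j} → i ≡ - j → j ≡ - i
  swap {i} {j} i≡-j = trans (sym (neg-involutive j)) (cong -_ (sym i≡-j))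

properᶠ : ∀ {m} → SignedGraph m → Vec ℤ m → Bool
properᶠ G κ = andᶠ λ v → andᶠ λ w → compatible (G v w) (lookup κ v) (lookup κ w)

-- The edge test inside properᵇ is a local function of Defs that cannot be named here, so the
-- two formulations are compared through their truth conditions.
properᵇ≡properᶠ : ∀ {m} (G : SignedGraph m) κ → properᵇ G κ ≡ properᶠ G κ
properᵇ≡properᶠ {m} G κ = bool-ext
  (λ eq → andᶠ-intro _ λ v → andᶠ-intro _ λ w → sound eq v w)
  (λ eq → complete λ v w → andᶠ-elim _ (andᶠ-elim _ eq v) w)
  where
  Compatible : Fin m → Fin m → Set
  Compatible v w = compatible (G v w) (lookup κ v) (lookup κ w) ≡ true
  sound : properᵇ G κ ≡ true → ∀ v w → Compatible v w
  sound eq v w with andᶠ-elim _ (andᶠ-elim _ (trans (sym (and-allPairs {m} _)) eq) v) w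
  ... | vw with G v w
  ...   | noEdge = refl
  ...   | pos    = vw
  ...   | neg    = vw
  complete : (∀ v w → Compatible v w) → properᵇ G κ ≡ true
  complete all with properᵇ G κ in eq
  ... | true  = refl
  ... | false with andᶠ-false _ (trans (sym (and-allPairs {m} _)) eq)
  ...   | v , v-false with andᶠ-false _ v-false
  ...     | w , vw-false with G v w in e | all v w
  ...       | pos | ok = contradiction (trans (sym ok) vw-false) λ ()
  ...       | neg | ok = contradiction (trans (sym ok) vw-false) λ ()

edgeBetween : Bool → Bool → Edge → Edge → Edge
edgeBetween true  _     e₁ e₂ = e₁
edgeBetween false true  e₁ e₂ = e₂
edgeBetween false false e₁ e₂ = noEdge

T-unfold : ∀ {n} (a : Vec Tri n) u v →
           T a u v ≡ edgeBetween ⌊ u <ᶠ? v ⌋ ⌊ v <ᶠ? u ⌋ (laterEdge a v) (laterEdge a u)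
T-unfold a u v with ⌊ u <ᶠ? v ⌋ | ⌊ v <ᶠ? u ⌋
... | true  | _     = refl
... | false | true  = refl
... | false | false = refl

lookup-∷ʳ-inject₁ : ∀ {n} (xs : Vec A n) y i → lookup (xs ∷ʳ y) (inject₁ i) ≡ lookup xs i
lookup-∷ʳ-inject₁ (x ∷ xs) y fzero    = refl
lookup-∷ʳ-inject₁ (x ∷ xs) y (fsuc i) = lookup-∷ʳ-inject₁ xs y i

lookup-∷ʳ-last : ∀ {n} (xs : Vec A n) y → lookup (xs ∷ʳ y) (fromℕ n) ≡ y
lookup-∷ʳ-last []       y = refl
lookup-∷ʳ-last (x ∷ xs) y = lookup-∷ʳ-last xs y

module _ {n : ℕ} (a : Vec Tri n) (x : Tri) where

  private
    new : Fin (suc (suc n))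
    new = fromℕ (suc n)

    inject₁<new : ∀ u → ⌊ inject₁ u <ᶠ? new ⌋ ≡ true
    inject₁<new u = ⌊⌋-true (inject₁ u <ᶠ? new)
      (subst₂ _<_ (sym (toℕ-inject₁ u)) (sym (toℕ-fromℕ (suc n))) (toℕ<n u))

    new≮inject₁ : ∀ u → ⌊ new <ᶠ? inject₁ u ⌋ ≡ false
    new≮inject₁ u = ⌊⌋-false (new <ᶠ? inject₁ u) λ new<u →
      ℕ.<-asym (subst₂ _<_ (toℕ-fromℕ (suc n)) (toℕ-inject₁ u) new<u) (toℕ<n u)

    laterEdge-inject₁ : ∀ v → laterEdge (a ∷ʳ x) (inject₁ v) ≡ laterEdge a v
    laterEdge-inject₁ fzero    = refl
    laterEdge-inject₁ (fsuc i) = cong triEdge (lookup-∷ʳ-inject₁ a x i)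

    laterEdge-new : laterEdge (a ∷ʳ x) new ≡ triEdge x
    laterEdge-new = cong triEdge (lookup-∷ʳ-last a x)

  T-∷ʳ-old : ∀ u v → T (a ∷ʳ x) (inject₁ u) (inject₁ v) ≡ T a u v
  T-∷ʳ-old u v rewrite T-unfold (a ∷ʳ x) (inject₁ u) (inject₁ v) | T-unfold a u v
    | toℕ-inject₁ u | toℕ-inject₁ v | laterEdge-inject₁ u | laterEdge-inject₁ v = refl

  T-∷ʳ-old-new : ∀ u → T (a ∷ʳ x) (inject₁ u) new ≡ triEdge x
  T-∷ʳ-old-new u rewrite T-unfold (a ∷ʳ x) (inject₁ u) new | inject₁<new u | laterEdge-new = refl

  T-∷ʳ-new-old : ∀ u → T (a ∷ʳ x) new (inject₁ u) ≡ triEdge x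
  T-∷ʳ-new-old u rewrite T-unfold (a ∷ʳ x) new (inject₁ u) | inject₁<new u | new≮inject₁ u | laterEdge-new = refl

T-loop : ∀ {n} (a : Vec Tri n) u → T a u u ≡ noEdge
T-loop a u rewrite T-unfold a u u | ⌊⌋-false (u <ᶠ? u) (ℕ.<-irrefl refl) = refl

newColourOK : ∀ {m} → Tri → ℤ → Vec ℤ m → Bool
newColourOK z  c κ = true
newColourOK p1 c κ = avoids c κ
newColourOK m1 c κ = avoids (- c) κ

avoids≡andᶠ : ∀ {m} d (κ : Vec ℤ m) → avoids d κ ≡ andᶠ (λ i → lookup κ i ≢ᵇ d)
avoids≡andᶠ d []      = refl
avoids≡andᶠ d (c ∷ κ) = cong (c ≢ᵇ d ∧_) (avoids≡andᶠ d κ)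

andᶠ-compatible-new : ∀ {m} x c (κ : Vec ℤ m) →
                      andᶠ (λ v → compatible (triEdge x) (lookup κ v) c) ≡ newColourOK x c κ
andᶠ-compatible-new     m1 c κ = sym (avoids≡andᶠ (- c) κ)
andᶠ-compatible-new {m} z  c κ = andᶠ-true {m}
andᶠ-compatible-new     p1 c κ = sym (avoids≡andᶠ c κ)

properᵇ-T-∷ʳ : ∀ {n} (a : Vec Tri n) x (κ : Vec ℤ (suc n)) c →
               properᵇ (T (a ∷ʳ x)) (κ ∷ʳ c) ≡ properᵇ (T a) κ ∧ newColourOK x c κ
properᵇ-T-∷ʳ {n} a x κ c = begin
    properᵇ (T (a ∷ʳ x)) (κ ∷ʳ c)
  ≡⟨ properᵇ≡properᶠ (T (a ∷ʳ x)) (κ ∷ʳ c) ⟩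
    andᶠ (λ v → andᶠ (ok v))
  ≡⟨ andᶠ-last (λ v → andᶠ (ok v)) ⟩
    andᶠ (λ v → andᶠ (ok (inject₁ v))) ∧ andᶠ (ok new)
  ≡⟨ cong₂ _∧_ (andᶠ-cong (λ v → andᶠ-last (ok (inject₁ v)))) (andᶠ-last (ok new)) ⟩
    andᶠ (λ v → andᶠ (λ w → ok (inject₁ v) (inject₁ w)) ∧ ok (inject₁ v) new)
      ∧ (andᶠ (λ w → ok new (inject₁ w)) ∧ ok new new)
  ≡⟨ cong₂ _∧_ (andᶠ-cong (λ v → cong₂ _∧_ (andᶠ-cong (old-old v)) (old-new v)))
               (cong₂ _∧_ (andᶠ-cong new-old) new-new) ⟩
    andᶠ (λ v → oldRow v ∧ compatible (triEdge x) (lookup κ v) c)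
      ∧ (andᶠ (λ w → compatible (triEdge x) c (lookup κ w)) ∧ true)
  ≡⟨ cong₂ _∧_ (andᶠ-∧ oldRow (λ v → compatible (triEdge x) (lookup κ v) c))
               (cong (_∧ true) (andᶠ-cong (λ w → compatible-sym (triEdge x) c (lookup κ w)))) ⟩
    (properᶠ (T a) κ ∧ andᶠ (λ v → compatible (triEdge x) (lookup κ v) c))
      ∧ (andᶠ (λ w → compatible (triEdge x) (lookup κ w) c) ∧ true)
  ≡⟨ cong (λ b → (properᶠ (T a) κ ∧ b) ∧ (b ∧ true)) (andᶠ-compatible-new x c κ) ⟩
    (properᶠ (T a) κ ∧ newColourOK x c κ) ∧ (newColourOK x c κ ∧ true)
  ≡⟨ absorb (properᶠ (T a) κ) (newColourOK x c κ) ⟩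
    properᶠ (T a) κ ∧ newColourOK x c κ
  ≡⟨ cong (_∧ newColourOK x c κ) (properᵇ≡properᶠ (T a) κ) ⟨
    properᵇ (T a) κ ∧ newColourOK x c κ
  ∎
  where
  open ≡-Reasoning
  new : Fin (suc (suc n))
  new = fromℕ (suc n)
  ok : Fin (suc (suc n)) → Fin (suc (suc n)) → Bool
  ok v w = compatible (T (a ∷ʳ x) v w) (lookup (κ ∷ʳ c) v) (lookup (κ ∷ʳ c) w)
  oldRow : Fin (suc n) → Bool
  oldRow v = andᶠ (λ w → compatible (T a v w) (lookup κ v) (lookup κ w))
  old-old : ∀ v w → ok (inject₁ v) (inject₁ w) ≡ compatible (T a v w) (lookup κ v) (lookup κ w)
  old-old v w rewrite T-∷ʳ-old a x v w | lookup-∷ʳ-inject₁ κ c v | lookup-∷ʳ-inject₁ κ c w = refl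
  old-new : ∀ v → ok (inject₁ v) new ≡ compatible (triEdge x) (lookup κ v) c
  old-new v rewrite T-∷ʳ-old-new a x v | lookup-∷ʳ-inject₁ κ c v | lookup-∷ʳ-last κ c = refl
  new-old : ∀ w → ok new (inject₁ w) ≡ compatible (triEdge x) c (lookup κ w)
  new-old w rewrite T-∷ʳ-new-old a x w | lookup-∷ʳ-inject₁ κ c w | lookup-∷ʳ-last κ c = refl
  new-new : ok new new ≡ true
  new-new rewrite T-loop (a ∷ʳ x) new = refl
  absorb : ∀ p b → (p ∧ b) ∧ (b ∧ true) ≡ p ∧ b
  absorb true  true  = refl
  absorb true  false = refl
  absorb false b     = refl

infix 7 _∈ᵇ_

_∈ᵇ_ : ℤ → List ℤ → Bool
d ∈ᵇ []      = false
d ∈ᵇ (c ∷ C) = ⌊ d ≟ c ⌋ ∨ d ∈ᵇ C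

Distinct : List ℤ → Set
Distinct []      = ⊤
Distinct (c ∷ C) = (c ∈ᵇ C ≡ false) × Distinct C

isSingle : List ℤ → ℤ → Bool
isSingle C c = not (- c ∈ᵇ C)

singles : List ℤ → ℕ
singles C = countᵇ (isSingle C) C

∈ᵇ-here : ∀ d C → d ∈ᵇ (d ∷ C) ≡ true
∈ᵇ-here d C rewrite ⌊⌋-true (d ≟ d) refl = refl

∈ᵇ-there : ∀ d c C → d ∈ᵇ C ≡ true → d ∈ᵇ (c ∷ C) ≡ true
∈ᵇ-there d c C d∈C rewrite d∈C = ∨-zeroʳ ⌊ d ≟ c ⌋

∈ᵇ-tail : ∀ d c C → d ∈ᵇ (c ∷ C) ≡ true → d ≢ c → d ∈ᵇ C ≡ true
∈ᵇ-tail d c C d∈ d≢c rewrite ⌊⌋-false (d ≟ c) d≢c = d∈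

countᵇ-cong-∈ : ∀ {p q : ℤ → Bool} C → (∀ c → c ∈ᵇ C ≡ true → p c ≡ q c) → countᵇ p C ≡ countᵇ q C
countᵇ-cong-∈ []      p≗q = refl
countᵇ-cong-∈ (c ∷ C) p≗q =
  cong₂ _+_ (cong 𝟙 (p≗q c (∈ᵇ-here c C))) (countᵇ-cong-∈ C (λ d d∈C → p≗q d (∈ᵇ-there d c C d∈C)))

∑-cong-∈ : ∀ {g h : ℤ → ℕ} C → (∀ c → c ∈ᵇ C ≡ true → g c ≡ h c) → ∑[ c ∈ C ] g c ≡ ∑[ c ∈ C ] h c
∑-cong-∈ []      g≗h = refl
∑-cong-∈ (c ∷ C) g≗h = cong₂ _+_ (g≗h c (∈ᵇ-here c C)) (∑-cong-∈ C (λ d d∈C → g≗h d (∈ᵇ-there d c C d∈C)))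

count-≟-∉ : ∀ d C → d ∈ᵇ C ≡ false → countᵇ (λ c → ⌊ c ≟ d ⌋) C ≡ 0
count-≟-∉ d []      _   = refl
count-≟-∉ d (c ∷ C) d∉ =
  cong₂ _+_ (cong 𝟙 (trans (≟-sym c d) (∨-conicalˡ _ _ d∉))) (count-≟-∉ d C (∨-conicalʳ _ _ d∉))

count-≟-∈ : ∀ d C → Distinct C → d ∈ᵇ C ≡ true → countᵇ (λ c → ⌊ c ≟ d ⌋) C ≡ 1
count-≟-∈ d (c ∷ C) (c∉C , distinct) d∈ with c ≟ d
... | yes refl = cong suc (count-≟-∉ c C c∉C)
... | no  c≢d  = count-≟-∈ d C distinct (∈ᵇ-tail d c C d∈ (λ d≡c → c≢d (sym d≡c)))

∈ᵇ-remove : ∀ x d C → x ∈ᵇ remove d C ≡ x ∈ᵇ C ∧ x ≢ᵇ d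
∈ᵇ-remove x d []      = refl
∈ᵇ-remove x d (c ∷ C) with c ≟ d
... | yes refl = trans (∈ᵇ-remove x c C) removed
  where
  removed : x ∈ᵇ C ∧ x ≢ᵇ c ≡ (⌊ x ≟ c ⌋ ∨ x ∈ᵇ C) ∧ x ≢ᵇ c
  removed with x ≟ c
  ... | yes _ = ∧-zeroʳ (x ∈ᵇ C)
  ... | no  _ = refl
... | no c≢d = trans (cong (⌊ x ≟ c ⌋ ∨_) (∈ᵇ-remove x d C)) kept
  where
  kept : ⌊ x ≟ c ⌋ ∨ (x ∈ᵇ C ∧ x ≢ᵇ d) ≡ (⌊ x ≟ c ⌋ ∨ x ∈ᵇ C) ∧ x ≢ᵇ d
  kept with x ≟ c
  ... | yes refl rewrite ⌊⌋-false (x ≟ d) c≢d = refl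
  ... | no  _    = refl

Distinct-remove : ∀ d C → Distinct C → Distinct (remove d C)
Distinct-remove d []      _                = tt
Distinct-remove d (c ∷ C) (c∉C , distinct) with c ≟ d
... | yes _ = Distinct-remove d C distinct
... | no  _ = trans (∈ᵇ-remove c d C) (cong (_∧ _) c∉C) , Distinct-remove d C distinct

remove-∉ : ∀ d C → d ∈ᵇ C ≡ false → remove d C ≡ C
remove-∉ d []      _  = refl
remove-∉ d (c ∷ C) d∉ with c ≟ d
... | yes refl = contradiction (trans (sym (∈ᵇ-here c C)) d∉) λ ()
... | no  _    = cong (c ∷_) (remove-∉ d C (∨-conicalʳ _ _ d∉))

∉-remove : ∀ x d C → x ∈ᵇ C ≡ false → x ∈ᵇ remove d C ≡ false
∉-remove x d C x∉ = trans (∈ᵇ-remove x d C) (cong (_∧ _) x∉)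

length-remove : ∀ d C → Distinct C → d ∈ᵇ C ≡ true → suc (length (remove d C)) ≡ length C
length-remove d C distinct d∈ = begin
    suc (length (remove d C))                              ≡⟨ cong suc (length-filterᵇ (_≢ᵇ d) C) ⟩
    1 + countᵇ (_≢ᵇ d) C                                   ≡⟨ cong (_+ countᵇ (_≢ᵇ d) C) (count-≟-∈ d C distinct d∈) ⟨
    countᵇ (λ c → ⌊ c ≟ d ⌋) C + countᵇ (λ c → not ⌊ c ≟ d ⌋) C ≡⟨ countᵇ-+-countᵇ-not _ C ⟩
    length C                                               ∎
  where open ≡-Reasoning

singles-remove : ∀ d C → singles (remove d C) ≡ countᵇ (λ c → c ≢ᵇ d ∧ not (- c ∈ᵇ C ∧ - c ≢ᵇ d)) C
singles-remove d C = trans (countᵇ-filterᵇ (isSingle (remove d C)) _ C)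
  (countᵇ-cong (λ c → cong (λ b → c ≢ᵇ d ∧ not b) (∈ᵇ-remove (- c) d C)) C)

-≡⇒≡- : ∀ {c d : ℤ} → - c ≡ d → c ≡ - d
-≡⇒≡- {c} refl = sym (neg-involutive c)

≡-⇒≡0 : ∀ (d : ℤ) → d ≡ - d → d ≡ 0ℤ
≡-⇒≡0 +0        _  = refl
≡-⇒≡0 +[1+ n ]  ()
≡-⇒≡0 -[1+ n ]  ()

singles-remove-single : ∀ d C → Distinct C → d ∈ᵇ C ≡ true → - d ∈ᵇ C ≡ false →
                        suc (singles (remove d C)) ≡ singles C
singles-remove-single d C distinct d∈ -d∉ = begin
    suc (singles (remove d C))
  ≡⟨ cong suc (trans (singles-remove d C) (countᵇ-cong-∈ C other-singles)) ⟩
    suc (countᵇ other C)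
  ≡⟨ ℕ.+-comm 1 (countᵇ other C) ⟩
    countᵇ other C + 1
  ≡⟨ cong (_+_ (countᵇ other C)) (count-≟-∈ d C distinct d∈) ⟨
    countᵇ other C + countᵇ (λ c → ⌊ c ≟ d ⌋) C
  ≡⟨ countᵇ-∨ other _ disjoint C ⟨
    countᵇ (λ c → other c ∨ ⌊ c ≟ d ⌋) C
  ≡⟨ countᵇ-cong-∈ C with-d ⟩
    singles C
  ∎
  where
  open ≡-Reasoning
  other : ℤ → Bool
  other c = isSingle C c ∧ c ≢ᵇ d
  -c≢d : ∀ {c} → c ∈ᵇ C ≡ true → - c ≢ d
  -c≢d {c} c∈ -c≡d = contradiction (trans (sym (trans (cong (_∈ᵇ C) (sym (-≡⇒≡- -c≡d))) c∈)) -d∉) λ ()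
  other-singles : ∀ c → c ∈ᵇ C ≡ true → (c ≢ᵇ d ∧ not (- c ∈ᵇ C ∧ - c ≢ᵇ d)) ≡ other c
  other-singles c c∈ with c ≟ d
  ... | yes _ = sym (∧-zeroʳ _)
  ... | no  _ rewrite ⌊⌋-false (- c ≟ d) (-c≢d c∈) =
    trans (cong not (∧-identityʳ _)) (sym (∧-identityʳ _))
  disjoint : ∀ c → other c ∧ ⌊ c ≟ d ⌋ ≡ false
  disjoint c with c ≟ d
  ... | yes _ = cong (_∧ true) (∧-zeroʳ (isSingle C c))
  ... | no  _ = ∧-zeroʳ _
  with-d : ∀ c → c ∈ᵇ C ≡ true → other c ∨ ⌊ c ≟ d ⌋ ≡ isSingle C c
  with-d c c∈ with c ≟ d
  ... | yes refl rewrite -d∉ = refl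
  ... | no  _    = trans (∨-identityʳ _) (∧-identityʳ _)

singles-remove-paired : ∀ d C → Distinct C → 0ℤ ∈ᵇ C ≡ false → d ∈ᵇ C ≡ true → - d ∈ᵇ C ≡ true →
                        singles (remove d C) ≡ suc (singles C)
singles-remove-paired d C distinct 0∉ d∈ -d∈ = begin
    singles (remove d C)
  ≡⟨ trans (singles-remove d C) (countᵇ-cong-∈ C with-partner) ⟩
    countᵇ (λ c → isSingle C c ∨ ⌊ c ≟ - d ⌋) C
  ≡⟨ countᵇ-∨ (isSingle C) _ disjoint C ⟩
    singles C + countᵇ (λ c → ⌊ c ≟ - d ⌋) C
  ≡⟨ cong (_+_ (singles C)) (count-≟-∈ (- d) C distinct -d∈) ⟩
    singles C + 1
  ≡⟨ ℕ.+-comm (singles C) 1 ⟩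
    suc (singles C)
  ∎
  where
  open ≡-Reasoning
  c≢-c : ∀ {c} → c ∈ᵇ C ≡ true → c ≢ - c
  c≢-c {c} c∈ c≡-c = contradiction (trans (sym c∈) (trans (cong (_∈ᵇ C) (≡-⇒≡0 c c≡-c)) 0∉)) λ ()
  with-partner : ∀ c → c ∈ᵇ C ≡ true → (c ≢ᵇ d ∧ not (- c ∈ᵇ C ∧ - c ≢ᵇ d)) ≡ isSingle C c ∨ ⌊ c ≟ - d ⌋
  with-partner c c∈ with c ≟ d
  ... | yes refl rewrite -d∈ | ⌊⌋-false (c ≟ - c) (c≢-c c∈) = refl
  ... | no  _ with - c ≟ d
  ...   | yes -c≡d rewrite ⌊⌋-true (c ≟ - d) (-≡⇒≡- -c≡d) = trans (cong not (∧-zeroʳ _)) (sym (∨-zeroʳ _))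
  ...   | no  -c≢d rewrite ⌊⌋-false (c ≟ - d) (λ c≡-d → -c≢d (trans (cong -_ c≡-d) (neg-involutive d))) =
    trans (cong not (∧-identityʳ _)) (sym (∨-identityʳ _))
  disjoint : ∀ c → isSingle C c ∧ ⌊ c ≟ - d ⌋ ≡ false
  disjoint c with c ≟ - d
  ... | yes refl rewrite neg-involutive d | d∈ = refl
  ... | no  _    = ∧-zeroʳ _

paired≡length∸singles : ∀ C → countᵇ (λ c → - c ∈ᵇ C) C ≡ length C ∸ singles C
paired≡length∸singles C =
  trans (sym (ℕ.m+n∸n≡m _ (singles C))) (cong (_∸ singles C) (countᵇ-+-countᵇ-not (λ c → - c ∈ᵇ C) C))

-- Counting the colourings of T a

-- colourings a l μ counts the proper colourings of T a from any zero-free list of l distinct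
-- colours of which μ are singles (their negative is not available).
colouringsStep : Tri → (ℕ → ℕ → ℕ) → ℕ → ℕ → ℕ
colouringsStep z  g l μ = l * g l μ
colouringsStep p1 g l μ = (l ∸ μ) * g (l ∸ 1) (suc μ) + μ * g (l ∸ 1) (μ ∸ 1)
colouringsStep m1 g l μ = (l ∸ μ) * g (l ∸ 1) (suc μ) + μ * g l μ

colourings : ∀ {n} → Vec Tri n → ℕ → ℕ → ℕ
colourings = foldl′ (λ g x → colouringsStep x g) (λ l μ → l)

colourings-∷ʳ : ∀ {n} (a : Vec Tri n) x l μ → colourings (a ∷ʳ x) l μ ≡ colouringsStep x (colourings a) l μ
colourings-∷ʳ a x l μ = cong (λ g → g l μ) (foldl-∷ʳ _ (λ g x → colouringsStep x g) (λ l μ → l) x a)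

CountsColourings : ∀ {n} → Vec Tri n → Set
CountsColourings {n} a = ∀ C → Distinct C → 0ℤ ∈ᵇ C ≡ false →
                         countMaps (suc n) (properᵇ (T a)) C ≡ colourings a (length C) (singles C)

∑-by-partner : ∀ C (F : ℤ → ℕ) paired single →
               (∀ c → c ∈ᵇ C ≡ true → F c ≡ (if - c ∈ᵇ C then paired else single)) →
               ∑[ c ∈ C ] F c ≡ (length C ∸ singles C) * paired + singles C * single
∑-by-partner C F paired single F-by-partner = begin
    ∑[ c ∈ C ] F c
  ≡⟨ ∑-cong-∈ C F-by-partner ⟩
    ∑[ c ∈ C ] (if - c ∈ᵇ C then paired else single)
  ≡⟨ ∑-if _ paired single C ⟩
    countᵇ (λ c → - c ∈ᵇ C) C * paired + singles C * single
  ≡⟨ cong (λ k → k * paired + singles C * single) (paired≡length∸singles C) ⟩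
    (length C ∸ singles C) * paired + singles C * single
  ∎
  where open ≡-Reasoning

countMaps-avoiding : ∀ {n} (a : Vec Tri n) → CountsColourings a → ∀ d C → Distinct C → 0ℤ ∈ᵇ C ≡ false →
                     d ∈ᵇ C ≡ true → countMaps (suc n) (λ κ → properᵇ (T a) κ ∧ avoids d κ) C
                                       ≡ colourings a (length C ∸ 1) (singles (remove d C))
countMaps-avoiding {n} a IH d C distinct 0∉ d∈ = begin
    countMaps (suc n) (λ κ → properᵇ (T a) κ ∧ avoids d κ) C
  ≡⟨ countMaps-avoids (suc n) _ d C ⟩
    countMaps (suc n) (properᵇ (T a)) (remove d C)
  ≡⟨ IH (remove d C) (Distinct-remove d C distinct) (∉-remove 0ℤ d C 0∉) ⟩
    colourings a (length (remove d C)) (singles (remove d C))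
  ≡⟨ cong (λ k → colourings a k (singles (remove d C))) (cong (_∸ 1) (length-remove d C distinct d∈)) ⟩
    colourings a (length C ∸ 1) (singles (remove d C))
  ∎
  where open ≡-Reasoning

-- A colour c of the new vertex rules out one colour for the old vertices (c for p1, −c for m1),
-- and removing a colour changes the number of singles by ±1 according to whether its partner
-- −c is available.
count-new-vertex : ∀ {n} (a : Vec Tri n) → CountsColourings a → ∀ x C → Distinct C → 0ℤ ∈ᵇ C ≡ false →
                   ∑[ c ∈ C ] countMaps (suc n) (λ κ → properᵇ (T a) κ ∧ newColourOK x c κ) C
                     ≡ colouringsStep x (colourings a) (length C) (singles C)
count-new-vertex {n} a IH z C distinct 0∉ = begin
    ∑[ c ∈ C ] countMaps (suc n) (λ κ → properᵇ (T a) κ ∧ true) C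
  ≡⟨ ∑-cong (λ c → trans (countMaps-cong (suc n) (λ κ → ∧-identityʳ _) C) (IH C distinct 0∉)) C ⟩
    ∑[ c ∈ C ] colourings a (length C) (singles C)
  ≡⟨ ∑-const _ C ⟩
    length C * colourings a (length C) (singles C)
  ∎
  where open ≡-Reasoning
count-new-vertex {n} a IH p1 C distinct 0∉ = ∑-by-partner C _ _ _ by-colour
  where
  by-colour : ∀ c → c ∈ᵇ C ≡ true →
              countMaps (suc n) (λ κ → properᵇ (T a) κ ∧ avoids c κ) C
                ≡ (if - c ∈ᵇ C then colourings a (length C ∸ 1) (suc (singles C))
                               else colourings a (length C ∸ 1) (singles C ∸ 1))
  by-colour c c∈ with - c ∈ᵇ C in -c∈
  ... | true  = trans (countMaps-avoiding a IH c C distinct 0∉ c∈)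
                      (cong (colourings a _) (singles-remove-paired c C distinct 0∉ c∈ -c∈))
  ... | false = trans (countMaps-avoiding a IH c C distinct 0∉ c∈)
                      (cong (λ k → colourings a (length C ∸ 1) (k ∸ 1)) (singles-remove-single c C distinct c∈ -c∈))
count-new-vertex {n} a IH m1 C distinct 0∉ = ∑-by-partner C _ _ _ by-colour
  where
  neg-neg-∈ : ∀ {c} → c ∈ᵇ C ≡ true → - - c ∈ᵇ C ≡ true
  neg-neg-∈ {c} = trans (cong (_∈ᵇ C) (neg-involutive c))
  by-colour : ∀ c → c ∈ᵇ C ≡ true →
              countMaps (suc n) (λ κ → properᵇ (T a) κ ∧ avoids (- c) κ) C
                ≡ (if - c ∈ᵇ C then colourings a (length C ∸ 1) (suc (singles C))
                               else colourings a (length C) (singles C))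
  by-colour c c∈ with - c ∈ᵇ C in -c∈
  ... | true  = trans (countMaps-avoiding a IH (- c) C distinct 0∉ -c∈)
                      (cong (colourings a _) (singles-remove-paired (- c) C distinct 0∉ -c∈ (neg-neg-∈ c∈)))
  ... | false = trans (countMaps-avoids (suc n) _ (- c) C)
                      (trans (cong (countMaps (suc n) (properᵇ (T a))) (remove-∉ (- c) C -c∈)) (IH C distinct 0∉))

countMaps-properᵇ-T : ∀ {n} (a : Vec Tri n) → CountsColourings a
countMaps-properᵇ-T = ∷ʳ-induction CountsColourings base step
  where
  base : CountsColourings []
  base C _ _ = trans (countMaps-∷ zero _ C) (trans (∑-const 1 C) (ℕ.*-identityʳ (length C)))
  step : ∀ {n} (a : Vec Tri n) x → CountsColourings a → CountsColourings (a ∷ʳ x)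
  step {n} a x IH C distinct 0∉ = begin
      countMaps (suc (suc n)) (properᵇ (T (a ∷ʳ x))) C
    ≡⟨ countMaps-∷ʳ (suc n) _ C ⟩
      ∑[ c ∈ C ] countMaps (suc n) (λ κ → properᵇ (T (a ∷ʳ x)) (κ ∷ʳ c)) C
    ≡⟨ ∑-cong (λ c → countMaps-cong (suc n) (λ κ → properᵇ-T-∷ʳ a x κ c) C) C ⟩
      ∑[ c ∈ C ] countMaps (suc n) (λ κ → properᵇ (T a) κ ∧ newColourOK x c κ) C
    ≡⟨ count-new-vertex a IH x C distinct 0∉ ⟩
      colouringsStep x (colourings a) (length C) (singles C)
    ≡⟨ colourings-∷ʳ a x (length C) (singles C) ⟨
      colourings (a ∷ʳ x) (length C) (singles C)
    ∎
    where open ≡-Reasoning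

-- The (λ, μ)-colour sets with λ − μ even

pairs : ℕ → ℕ → List ℤ
pairs s t = concatMap (λ i → + i ∷ - (+ i) ∷ []) (range s t)

positives : ℕ → ℕ → List ℤ
positives s t = map +_ (range s t)

∈ᵇ-++ : ∀ x C D → x ∈ᵇ (C ++ D) ≡ x ∈ᵇ C ∨ x ∈ᵇ D
∈ᵇ-++ x []      D = refl
∈ᵇ-++ x (c ∷ C) D = trans (cong (⌊ x ≟ c ⌋ ∨_) (∈ᵇ-++ x C D)) (sym (∨-assoc ⌊ x ≟ c ⌋ _ _))

0∉pairs : ∀ s t → 0ℤ ∈ᵇ pairs s t ≡ false
0∉pairs s zero    = refl
0∉pairs s (suc t) = 0∉pairs (suc s) t

0∉positives : ∀ s t → 0ℤ ∈ᵇ positives s t ≡ false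
0∉positives s zero    = refl
0∉positives s (suc t) = 0∉positives (suc s) t

+∉pairs : ∀ j s t → j ≤ s → + j ∈ᵇ pairs s t ≡ false
+∉pairs j s zero    _   = refl
+∉pairs j s (suc t) j≤s rewrite ⌊⌋-false (+ j ≟ + suc s) (λ eq → ℕ.<-irrefl (+-injective eq) (s≤s j≤s)) =
  +∉pairs j (suc s) t (ℕ.m≤n⇒m≤1+n j≤s)

-∉pairs-below : ∀ j s t → j < s → -[1+ j ] ∈ᵇ pairs s t ≡ false
-∉pairs-below j s zero    _   = refl
-∉pairs-below j s (suc t) j<s rewrite ⌊⌋-false (-[1+ j ] ≟ -[1+ s ]) (λ eq → ℕ.<-irrefl (-[1+-injective eq) j<s) =
  -∉pairs-below j (suc s) t (ℕ.m≤n⇒m≤1+n j<s)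

-∉pairs-above : ∀ j s t → s + t ≤ j → -[1+ j ] ∈ᵇ pairs s t ≡ false
-∉pairs-above j s zero    _     = refl
-∉pairs-above j s (suc t) s+t≤j
  rewrite ⌊⌋-false (-[1+ j ] ≟ -[1+ s ])
                   (λ eq → ℕ.<-irrefl (sym (-[1+-injective eq)) (ℕ.<-≤-trans (ℕ.m<m+n s (s≤s z≤n)) s+t≤j)) =
  -∉pairs-above j (suc s) t (subst (_≤ j) (ℕ.+-suc s t) s+t≤j)

+∉positives : ∀ j s t → j ≤ s → + j ∈ᵇ positives s t ≡ false
+∉positives j s zero    _   = refl
+∉positives j s (suc t) j≤s rewrite ⌊⌋-false (+ j ≟ + suc s) (λ eq → ℕ.<-irrefl (+-injective eq) (s≤s j≤s)) =
  +∉positives j (suc s) t (ℕ.m≤n⇒m≤1+n j≤s)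

-∉positives : ∀ j s t → -[1+ j ] ∈ᵇ positives s t ≡ false
-∉positives j s zero    = refl
-∉positives j s (suc t) = -∉positives j (suc s) t

pairs-closed : ∀ c s t → c ∈ᵇ pairs s t ≡ true → - c ∈ᵇ pairs s t ≡ true
pairs-closed c s (suc t) c∈ with c ≟ + suc s
... | yes refl = ∈ᵇ-there -[1+ s ] (+ suc s) (-[1+ s ] ∷ pairs (suc s) t) (∈ᵇ-here -[1+ s ] (pairs (suc s) t))
... | no  _ with c ≟ -[1+ s ]
...   | yes refl = ∈ᵇ-here (+ suc s) (-[1+ s ] ∷ pairs (suc s) t)
...   | no  _    = ∈ᵇ-there (- c) (+ suc s) (-[1+ s ] ∷ pairs (suc s) t)
                     (∈ᵇ-there (- c) -[1+ s ] (pairs (suc s) t) (pairs-closed c (suc s) t c∈))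

∈positives : ∀ c s t → c ∈ᵇ positives s t ≡ true → Σ[ j ∈ ℕ ] c ≡ + suc j × s ≤ j
∈positives c s (suc t) c∈ with c ≟ + suc s
... | yes refl = s , refl , ℕ.≤-refl
... | no  _ with ∈positives c (suc s) t c∈
...   | j , refl , s<j = j , refl , ℕ.<⇒≤ s<j

Distinct-positives : ∀ s t → Distinct (positives s t)
Distinct-positives s zero    = tt
Distinct-positives s (suc t) = +∉positives (suc s) (suc s) t ℕ.≤-refl , Distinct-positives (suc s) t

Distinct-pairs++positives : ∀ s t μ → Distinct (pairs s t ++ positives (s + t) μ)
Distinct-pairs++positives s zero μ rewrite ℕ.+-identityʳ s = Distinct-positives s μ
Distinct-pairs++positives s (suc t) μ rewrite ℕ.+-suc s t =
    trans (∈ᵇ-++ _ (pairs (suc s) t) _)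
          (cong₂ _∨_ (+∉pairs (suc s) (suc s) t ℕ.≤-refl) (+∉positives (suc s) (suc (s + t)) μ (s≤s (ℕ.m≤m+n s t))))
  , trans (∈ᵇ-++ _ (pairs (suc s) t) _) (cong₂ _∨_ (-∉pairs-below s (suc s) t ℕ.≤-refl) (-∉positives s _ μ))
  , Distinct-pairs++positives (suc s) t μ

length-range : ∀ s t → length (range s t) ≡ t
length-range s zero    = refl
length-range s (suc t) = cong suc (length-range (suc s) t)

length-pairs : ∀ s t → length (pairs s t) ≡ t * 2
length-pairs s zero    = refl
length-pairs s (suc t) = cong (λ k → suc (suc k)) (length-pairs (suc s) t)

length-positives : ∀ s t → length (positives s t) ≡ t
length-positives s t = trans (length-map +_ (range s t)) (length-range s t)

singles-pairs++positives : ∀ k μ → singles (pairs 0 k ++ positives k μ) ≡ μ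
singles-pairs++positives k μ = begin
    singles C
  ≡⟨ countᵇ-++ (isSingle C) (pairs 0 k) (positives k μ) ⟩
    countᵇ (isSingle C) (pairs 0 k) + countᵇ (isSingle C) (positives k μ)
  ≡⟨ cong₂ _+_ (trans (countᵇ-cong-∈ (pairs 0 k) paired) (countᵇ-false (λ _ → refl) (pairs 0 k)))
               (trans (countᵇ-cong-∈ (positives k μ) single) (countᵇ-true (positives k μ))) ⟩
    length (positives k μ)
  ≡⟨ length-positives k μ ⟩
    μ
  ∎
  where
  open ≡-Reasoning
  C = pairs 0 k ++ positives k μ
  paired : ∀ c → c ∈ᵇ pairs 0 k ≡ true → isSingle C c ≡ false
  paired c c∈ rewrite ∈ᵇ-++ (- c) (pairs 0 k) (positives k μ) | pairs-closed c 0 k c∈ = refl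
  single : ∀ c → c ∈ᵇ positives k μ ≡ true → isSingle C c ≡ true
  single c c∈ with ∈positives c k μ c∈
  ... | j , refl , k≤j rewrite ∈ᵇ-++ -[1+ j ] (pairs 0 k) (positives k μ)
                             | -∉pairs-above j 0 k k≤j | -∉positives j k μ = refl

module _ (l μ : ℕ) (μ≤l : μ ≤ l) (even : (l ∸ μ) % 2 ≡ 0) where

  private
    k = (l ∸ μ) / 2

  colourSet-even : colourSet l μ ≡ pairs 0 k ++ positives k μ
  colourSet-even rewrite even = cong (pairs 0 k ++_) (++-identityʳ _)

  length-colourSet : length (pairs 0 k ++ positives k μ) ≡ l
  length-colourSet = begin
      length (pairs 0 k ++ positives k μ)         ≡⟨ length-++ (pairs 0 k) ⟩
      length (pairs 0 k) + length (positives k μ) ≡⟨ cong₂ _+_ (length-pairs 0 k) (length-positives k μ) ⟩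
      k * 2 + μ                                   ≡⟨ cong (_+ μ) (trans (m≡m%n+[m/n]*n (l ∸ μ) 2) (cong (_+ k * 2) even)) ⟨
      (l ∸ μ) + μ                                 ≡⟨ ℕ.m∸n+n≡m μ≤l ⟩
      l                                           ∎
    where open ≡-Reasoning

  f-T≡colourings : ∀ {n} (a : Vec Tri n) → f (T a) l μ ≡ colourings a l μ
  f-T≡colourings {n} a = begin
      f (T a) l μ
    ≡⟨ length-filterᵇ (properᵇ (T a)) (allMaps (suc n) (colourSet l μ)) ⟩
      countMaps (suc n) (properᵇ (T a)) (colourSet l μ)
    ≡⟨ cong (countMaps (suc n) (properᵇ (T a))) colourSet-even ⟩
      countMaps (suc n) (properᵇ (T a)) C
    ≡⟨ countMaps-properᵇ-T a C (Distinct-pairs++positives 0 k μ)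
                                (trans (∈ᵇ-++ 0ℤ (pairs 0 k) _) (cong₂ _∨_ (0∉pairs 0 k) (0∉positives k μ))) ⟩
      colourings a (length C) (singles C)
    ≡⟨ cong₂ (colourings a) length-colourSet (singles-pairs++positives k μ) ⟩
      colourings a l μ
    ∎
    where
    open ≡-Reasoning
    C = pairs 0 k ++ positives k μ

-- Colour lists consisting of singles only, and of one pair ±c plus μ singles.
singlesOnly : ∀ {n} → Vec Tri n → ℕ → ℕ
singlesOnly a l = colourings a l l

onePair : ∀ {n} → Vec Tri n → ℕ → ℕ
onePair a μ = colourings a (2 + μ) μ

singlesOnly-∷ʳz : ∀ {n} (a : Vec Tri n) l → singlesOnly (a ∷ʳ z) l ≡ l * singlesOnly a l
singlesOnly-∷ʳz a l = colourings-∷ʳ a z l l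

singlesOnly-∷ʳm1 : ∀ {n} (a : Vec Tri n) l → singlesOnly (a ∷ʳ m1) l ≡ l * singlesOnly a l
singlesOnly-∷ʳm1 a l rewrite colourings-∷ʳ a m1 l l | ℕ.n∸n≡0 l = refl

singlesOnly-∷ʳp1 : ∀ {n} (a : Vec Tri n) l → singlesOnly (a ∷ʳ p1) l ≡ l * singlesOnly a (l ∸ 1)
singlesOnly-∷ʳp1 a l rewrite colourings-∷ʳ a p1 l l | ℕ.n∸n≡0 l = refl

onePair-∷ʳz : ∀ {n} (a : Vec Tri n) μ → onePair (a ∷ʳ z) μ ≡ (2 + μ) * onePair a μ
onePair-∷ʳz a μ = colourings-∷ʳ a z (2 + μ) μ

onePair-∷ʳp1 : ∀ {n} (a : Vec Tri n) μ →
               onePair (a ∷ʳ p1) μ ≡ 2 * singlesOnly a (suc μ) + μ * colourings a (suc μ) (μ ∸ 1)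
onePair-∷ʳp1 a μ rewrite colourings-∷ʳ a p1 (2 + μ) μ | ℕ.m+n∸n≡m 2 μ = refl

onePair-∷ʳm1 : ∀ {n} (a : Vec Tri n) μ → onePair (a ∷ʳ m1) μ ≡ 2 * singlesOnly a (suc μ) + μ * onePair a μ
onePair-∷ʳm1 a μ rewrite colourings-∷ʳ a m1 (2 + μ) μ | ℕ.m+n∸n≡m 2 μ = refl

singlesOnly-mono : ∀ {n} (a : Vec Tri n) l → singlesOnly a l ≤ singlesOnly a (suc l)
singlesOnly-mono = ∷ʳ-induction (λ a → ∀ l → singlesOnly a l ≤ singlesOnly a (suc l)) ℕ.n≤1+n step
  where
  step : ∀ {n} (a : Vec Tri n) x → (∀ l → singlesOnly a l ≤ singlesOnly a (suc l)) →
         ∀ l → singlesOnly (a ∷ʳ x) l ≤ singlesOnly (a ∷ʳ x) (suc l)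
  step a z  mono l rewrite singlesOnly-∷ʳz a l | singlesOnly-∷ʳz a (suc l) = ℕ.*-mono-≤ (ℕ.n≤1+n l) (mono l)
  step a m1 mono l rewrite singlesOnly-∷ʳm1 a l | singlesOnly-∷ʳm1 a (suc l) = ℕ.*-mono-≤ (ℕ.n≤1+n l) (mono l)
  step a p1 mono zero    rewrite singlesOnly-∷ʳp1 a 0 | singlesOnly-∷ʳp1 a 1 = z≤n
  step a p1 mono (suc l) rewrite singlesOnly-∷ʳp1 a (suc l) | singlesOnly-∷ʳp1 a (2 + l) =
    ℕ.*-mono-≤ (ℕ.n≤1+n (suc l)) (mono l)

singlesOnly-pos : ∀ {n} (a : Vec Tri n) l → n < l → 0 < singlesOnly a l
singlesOnly-pos = ∷ʳ-induction (λ {n} a → ∀ l → n < l → 0 < singlesOnly a l) (λ l 0<l → 0<l) step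
  where
  0<* : ∀ {m k} → 0 < m → 0 < k → 0 < m * k
  0<* = ℕ.*-mono-≤
  step : ∀ {n} (a : Vec Tri n) x → (∀ l → n < l → 0 < singlesOnly a l) →
         ∀ l → suc n < l → 0 < singlesOnly (a ∷ʳ x) l
  step {n} a z  positive l n<l rewrite singlesOnly-∷ʳz a l =
    0<* (ℕ.m<n⇒0<n n<l) (positive l (ℕ.<-trans (ℕ.n<1+n n) n<l))
  step {n} a m1 positive l n<l rewrite singlesOnly-∷ʳm1 a l =
    0<* (ℕ.m<n⇒0<n n<l) (positive l (ℕ.<-trans (ℕ.n<1+n n) n<l))
  step a p1 positive (suc l) (s≤s n<l) rewrite singlesOnly-∷ʳp1 a (suc l) = 0<* {suc l} (s≤s z≤n) (positive l n<l)

singlesOnly-strict : ∀ {n} (a : Vec Tri n) l → n ≤ l → singlesOnly a l < singlesOnly a (suc l)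
singlesOnly-strict {zero}  [] l _ = ℕ.n<1+n l
singlesOnly-strict {suc n} a  l n<l with initLast a
... | a′ , x , refl = step x l n<l
  where
  grow : ∀ l {u v} → u ≤ v → 0 < v → l * u < suc l * v
  grow l u≤v 0<v = ℕ.≤-<-trans (ℕ.*-monoʳ-≤ l u≤v) (ℕ.m<n+m _ 0<v)
  step : ∀ x l → suc n ≤ l → singlesOnly (a′ ∷ʳ x) l < singlesOnly (a′ ∷ʳ x) (suc l)
  step z  l n<l rewrite singlesOnly-∷ʳz a′ l | singlesOnly-∷ʳz a′ (suc l) =
    grow l (singlesOnly-mono a′ l) (singlesOnly-pos a′ (suc l) (s≤s (ℕ.<⇒≤ n<l)))
  step m1 l n<l rewrite singlesOnly-∷ʳm1 a′ l | singlesOnly-∷ʳm1 a′ (suc l) =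
    grow l (singlesOnly-mono a′ l) (singlesOnly-pos a′ (suc l) (s≤s (ℕ.<⇒≤ n<l)))
  step p1 (suc l) (s≤s n≤l) rewrite singlesOnly-∷ʳp1 a′ (suc l) | singlesOnly-∷ʳp1 a′ (2 + l) =
    grow (suc l) (singlesOnly-mono a′ l) (singlesOnly-pos a′ (suc l) (s≤s n≤l))

All-∷ʳ : ∀ {P : A → Set} {n} (xs : Vec A n) x → All P (xs ∷ʳ x) → All P xs × P x
All-∷ʳ []       x (px ∷ [])  = [] , px
All-∷ʳ (y ∷ xs) x (py ∷ pxs) with All-∷ʳ xs x pxs
... | pxs′ , px = (py ∷ pxs′) , px

-- Without negative edges the signs of the colours are irrelevant.
onePair-unsigned : ∀ {n} (a : Vec Tri n) → All (_≢ m1) a → ∀ μ → onePair a μ ≡ singlesOnly a (2 + μ)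
onePair-unsigned = ∷ʳ-induction (λ a → All (_≢ m1) a → ∀ μ → onePair a μ ≡ singlesOnly a (2 + μ)) (λ _ _ → refl) step
  where
  step : ∀ {n} (a : Vec Tri n) x → (All (_≢ m1) a → ∀ μ → onePair a μ ≡ singlesOnly a (2 + μ)) →
         All (_≢ m1) (a ∷ʳ x) → ∀ μ → onePair (a ∷ʳ x) μ ≡ singlesOnly (a ∷ʳ x) (2 + μ)
  step a x IH all μ with All-∷ʳ a x all
  step a m1 IH all μ       | _    , m1≢m1 = contradiction refl m1≢m1
  step a z  IH all μ       | all′ , _ rewrite onePair-∷ʳz a μ | singlesOnly-∷ʳz a (2 + μ) | IH all′ μ = refl
  step a p1 IH all zero    | all′ , _ rewrite onePair-∷ʳp1 a zero | singlesOnly-∷ʳp1 a 2 = ℕ.+-identityʳ _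
  step a p1 IH all (suc μ) | all′ , _ rewrite onePair-∷ʳp1 a (suc μ) | singlesOnly-∷ʳp1 a (3 + μ) =
    trans (cong (λ k → 2 * singlesOnly a (2 + μ) + suc μ * k) (IH all′ μ))
          (sym (ℕ.*-distribʳ-+ (singlesOnly a (2 + μ)) 2 (suc μ)))

Any-∷ʳp1 : ∀ {n} (a : Vec Tri n) → Any (_≡ m1) (a ∷ʳ p1) → Any (_≡ m1) a
Any-∷ʳp1 []      (here ())
Any-∷ʳp1 []      (there ())
Any-∷ʳp1 (x ∷ a) (here x≡m1) = here x≡m1
Any-∷ʳp1 (x ∷ a) (there any) = there (Any-∷ʳp1 a any)

onePair-signed-≤ : ∀ {n} (a : Vec Tri n) → All (_≢ z) a → ∀ μ → onePair a μ ≤ singlesOnly a (2 + μ)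
onePair-signed-≤ =
  ∷ʳ-induction (λ a → All (_≢ z) a → ∀ μ → onePair a μ ≤ singlesOnly a (2 + μ)) (λ _ _ → ℕ.≤-refl) step
  where
  step : ∀ {n} (a : Vec Tri n) x → (All (_≢ z) a → ∀ μ → onePair a μ ≤ singlesOnly a (2 + μ)) →
         All (_≢ z) (a ∷ʳ x) → ∀ μ → onePair (a ∷ʳ x) μ ≤ singlesOnly (a ∷ʳ x) (2 + μ)
  step a x IH all μ with All-∷ʳ a x all
  step a z  IH all μ       | _    , z≢z = contradiction refl z≢z
  step a p1 IH all zero    | all′ , _
    rewrite onePair-∷ʳp1 a zero | singlesOnly-∷ʳp1 a 2 | ℕ.+-identityʳ (2 * singlesOnly a 1) = ℕ.≤-refl
  step a p1 IH all (suc μ) | all′ , _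
    rewrite onePair-∷ʳp1 a (suc μ) | singlesOnly-∷ʳp1 a (3 + μ) | ℕ.*-distribʳ-+ (singlesOnly a (2 + μ)) 2 (suc μ) =
    ℕ.+-monoʳ-≤ (2 * singlesOnly a (2 + μ)) (ℕ.*-monoʳ-≤ (suc μ) (IH all′ μ))
  step a m1 IH all μ       | all′ , _
    rewrite onePair-∷ʳm1 a μ | singlesOnly-∷ʳm1 a (2 + μ) | ℕ.*-distribʳ-+ (singlesOnly a (2 + μ)) 2 μ =
    ℕ.+-mono-≤ (ℕ.*-monoʳ-≤ 2 (singlesOnly-mono a (suc μ))) (ℕ.*-monoʳ-≤ μ (IH all′ μ))

onePair-signed-< : ∀ {n} (a : Vec Tri n) → All (_≢ z) a → Any (_≡ m1) a →
                   ∀ μ → n ≤ μ → onePair a μ < singlesOnly a (2 + μ)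
onePair-signed-< = ∷ʳ-induction Strict (λ _ ()) step
  where
  Strict : ∀ {n} → Vec Tri n → Set
  Strict {n} a = All (_≢ z) a → Any (_≡ m1) a → ∀ μ → n ≤ μ → onePair a μ < singlesOnly a (2 + μ)
  step : ∀ {n} (a : Vec Tri n) x → Strict a → Strict (a ∷ʳ x)
  step a x IH all any μ n≤μ with All-∷ʳ a x all
  step a z  IH all any μ       n≤μ       | _    , z≢z = contradiction refl z≢z
  step a p1 IH all any (suc μ) (s≤s n≤μ) | all′ , _
    rewrite onePair-∷ʳp1 a (suc μ) | singlesOnly-∷ʳp1 a (3 + μ) | ℕ.*-distribʳ-+ (singlesOnly a (2 + μ)) 2 (suc μ) =
    ℕ.+-monoʳ-< (2 * singlesOnly a (2 + μ)) (ℕ.*-monoʳ-< (suc μ) (IH all′ (Any-∷ʳp1 a any) μ n≤μ))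
  step {n} a m1 IH all any μ   n<μ       | all′ , _
    rewrite onePair-∷ʳm1 a μ | singlesOnly-∷ʳm1 a (2 + μ) | ℕ.*-distribʳ-+ (singlesOnly a (2 + μ)) 2 μ =
    ℕ.+-mono-<-≤ (ℕ.*-monoʳ-< 2 (singlesOnly-strict a (suc μ) (ℕ.≤-trans (ℕ.n≤1+n n) (ℕ.m≤n⇒m≤1+n n<μ))))
                 (ℕ.*-monoʳ-≤ μ (onePair-signed-≤ a all′ μ))

-- Recovering a from the counts

isP1 : Tri → Bool
isP1 p1 = true
isP1 z  = false
isP1 m1 = false

positivePattern : ∀ {n} → Vec Tri n → Vec Bool n
positivePattern = Vec.map isP1

singlesOnly≡χ : ∀ {n} (a : Vec Tri n) l → + singlesOnly a l ≡ χ (positivePattern a) (+ l)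
singlesOnly≡χ = ∷ʳ-induction (λ a → ∀ l → + singlesOnly a l ≡ χ (positivePattern a) (+ l)) (λ l → refl) step
  where
  step : ∀ {n} (a : Vec Tri n) x → (∀ l → + singlesOnly a l ≡ χ (positivePattern a) (+ l)) →
         ∀ l → + singlesOnly (a ∷ʳ x) l ≡ χ (positivePattern (a ∷ʳ x)) (+ l)
  step a x IH l rewrite map-∷ʳ isP1 x a | χ-∷ʳ (positivePattern a) (isP1 x) (+ l) = by-sign x l
    where
    by-sign : ∀ x l → + singlesOnly (a ∷ʳ x) l ≡ χStep (isP1 x) (χ (positivePattern a)) (+ l)
    by-sign z  l       rewrite singlesOnly-∷ʳz a l = trans (ℤ.pos-* l _) (cong (+ l ℤ.*_) (IH l))
    by-sign m1 l       rewrite singlesOnly-∷ʳm1 a l = trans (ℤ.pos-* l _) (cong (+ l ℤ.*_) (IH l))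
    by-sign p1 zero    rewrite singlesOnly-∷ʳp1 a zero = refl
    by-sign p1 (suc l) rewrite singlesOnly-∷ʳp1 a (suc l) = trans (ℤ.pos-* (suc l) _) (cong (+ suc l ℤ.*_) (IH l))

m1-or-none : ∀ {n} (a : Vec Tri n) → Any (_≡ m1) a ⊎ All (_≢ m1) a
m1-or-none []       = inj₂ []
m1-or-none (m1 ∷ a) = inj₁ (here refl)
m1-or-none (z  ∷ a) with m1-or-none a
... | inj₁ any  = inj₁ (there any)
... | inj₂ none = inj₂ ((λ ()) ∷ none)
m1-or-none (p1 ∷ a) with m1-or-none a
... | inj₁ any  = inj₁ (there any)
... | inj₂ none = inj₂ ((λ ()) ∷ none)

positivePattern-injective : ∀ {P : Tri → Set} → (∀ {x y} → P x → P y → isP1 x ≡ isP1 y → x ≡ y) →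
                            ∀ {n} {a b : Vec Tri n} → All P a → All P b → positivePattern a ≡ positivePattern b → a ≡ b
positivePattern-injective inj []         []         _  = refl
positivePattern-injective inj (px ∷ pa) (py ∷ pb) eq with ∷-injective eq
... | x≡y , a≡b = cong₂ _∷_ (inj px py x≡y) (positivePattern-injective inj pa pb a≡b)

isP1-injective-unsigned : ∀ {x y} → x ≢ m1 → y ≢ m1 → isP1 x ≡ isP1 y → x ≡ y
isP1-injective-unsigned {m1} x≢m1 _ _ = contradiction refl x≢m1
isP1-injective-unsigned {_} {m1} _ y≢m1 _ = contradiction refl y≢m1
isP1-injective-unsigned {z}  {z}  _ _ _ = refl
isP1-injective-unsigned {p1} {p1} _ _ _ = refl

isP1-injective-signed : ∀ {x y} → x ≢ z → y ≢ z → isP1 x ≡ isP1 y → x ≡ y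
isP1-injective-signed {z} x≢z _ _ = contradiction refl x≢z
isP1-injective-signed {_} {z} _ y≢z _ = contradiction refl y≢z
isP1-injective-signed {m1} {m1} _ _ _ = refl
isP1-injective-signed {p1} {p1} _ _ _ = refl

admissible-injective : ∀ {n} {a b : Vec Tri n} → Admissible a → Admissible b → positivePattern a ≡ positivePattern b →
                       (All (_≢ m1) a → All (_≢ m1) b) → (All (_≢ m1) b → All (_≢ m1) a) → a ≡ b
admissible-injective (inj₁ A) (inj₁ B) same a⇒b b⇒a = positivePattern-injective isP1-injective-unsigned A B same
admissible-injective (inj₂ A) (inj₂ B) same a⇒b b⇒a = positivePattern-injective isP1-injective-signed A B same
admissible-injective (inj₁ A) (inj₂ B) same a⇒b b⇒a = positivePattern-injective isP1-injective-unsigned A (a⇒b A) same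
admissible-injective (inj₂ A) (inj₁ B) same a⇒b b⇒a = positivePattern-injective isP1-injective-unsigned (b⇒a B) B same

SameEvenColourings : ∀ {n} → Vec Tri n → Vec Tri n → Set
SameEvenColourings a b = ∀ l μ → μ ≤ l → (l ∸ μ) % 2 ≡ 0 → colourings a l μ ≡ colourings b l μ

module _ {n} {a b : Vec Tri n} (same : SameEvenColourings a b) where

  same-singlesOnly : ∀ l → singlesOnly a l ≡ singlesOnly b l
  same-singlesOnly l = same l l ℕ.≤-refl (cong (_% 2) (ℕ.n∸n≡0 l))

  same-onePair : ∀ μ → onePair a μ ≡ onePair b μ
  same-onePair μ = same (2 + μ) μ (ℕ.m≤n+m μ 2) (cong (_% 2) (ℕ.m+n∸n≡m 2 μ))

  same-positivePattern : positivePattern a ≡ positivePattern b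
  same-positivePattern = χ-injective (positivePattern a) (positivePattern b) λ l →
    trans (sym (singlesOnly≡χ a (ℕ.suc l))) (trans (cong +_ (same-singlesOnly (ℕ.suc l))) (singlesOnly≡χ b (ℕ.suc l)))

  -- For unsigned a the pair ±c costs nothing, while an entry −1 of a signed b makes it strictly costly.
  unsigned-preserved : All (_≢ m1) a → Admissible b → All (_≢ m1) b
  unsigned-preserved a-unsigned (inj₁ b-unsigned) = b-unsigned
  unsigned-preserved a-unsigned (inj₂ b-signed) with m1-or-none b
  ... | inj₂ none = none
  ... | inj₁ any  = contradiction equal (ℕ.<⇒≢ (onePair-signed-< b b-signed any n ℕ.≤-refl))
    where
    equal : onePair b n ≡ singlesOnly b (2 + n)
    equal = trans (sym (same-onePair n)) (trans (onePair-unsigned a a-unsigned n) (same-singlesOnly (2 + n)))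

colourings-injective : ∀ {n} {a b : Vec Tri n} → Admissible a → Admissible b → SameEvenColourings a b → a ≡ b
colourings-injective {a = a} {b} adm-a adm-b same = admissible-injective adm-a adm-b (same-positivePattern same)
  (λ a-unsigned → unsigned-preserved same a-unsigned adm-b)
  (λ b-unsigned → unsigned-preserved (λ l μ μ≤l even → sym (same l μ μ≤l even)) b-unsigned adm-a)

-- Isomorphism invariants

sum-⤖ : ∀ {m m′} (φ : Fin m ⤖ Fin m′) (g : Fin m′ → ℕ) → sum g ≡ sum (g ∘ Bijection.to φ)
sum-⤖ φ g = sum-permute g (⤖⇒↔ φ)

sum-const : ∀ {m} c → sum {m} (λ _ → c) ≡ m * c
sum-const {zero}  c = refl
sum-const {suc m} c = cong (_+_ c) (sum-const {m} c)

inject₁-or-last : ∀ {m} (v : Fin (suc m)) → (Σ[ u ∈ Fin m ] v ≡ inject₁ u) ⊎ v ≡ fromℕ m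
inject₁-or-last {zero}  fzero    = inj₂ refl
inject₁-or-last {suc m} fzero    = inj₁ (fzero , refl)
inject₁-or-last {suc m} (fsuc v) with inject₁-or-last v
... | inj₁ (u , v≡u) = inj₁ (fsuc u , cong fsuc v≡u)
... | inj₂ v≡last    = inj₂ (cong fsuc v≡last)

≅-sym : ∀ {m m′} {G₁ : SignedGraph m} {G₂ : SignedGraph m′} → G₁ ≅ G₂ → G₂ ≅ G₁
≅-sym {G₂ = G₂} iso = record
  { φ        = ⤖-sym φ
  ; preserve = λ u v → trans (sym (preserve _ _)) (cong₂ G₂ (back u) (back v))
  }
  where
  open _≅_ iso
  back : ∀ u → Bijection.to φ (Bijection.to (⤖-sym φ) u) ≡ u
  back u = proj₂ (Bijection.strictlySurjective φ u)

HasNegEdge : ∀ {m} → SignedGraph m → Set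
HasNegEdge {m} G = Σ[ u ∈ Fin m ] Σ[ v ∈ Fin m ] G u v ≡ neg

HasNegEdge-≅ : ∀ {m m′} {G₁ : SignedGraph m} {G₂ : SignedGraph m′} → G₁ ≅ G₂ → HasNegEdge G₁ → HasNegEdge G₂
HasNegEdge-≅ iso (u , v , uv-neg) = Bijection.to φ u , Bijection.to φ v , trans (preserve u v) uv-neg
  where open _≅_ iso

-- Vertex 0 is joined to every later vertex, by an edge of the sign of that vertex.
T-HasNegEdge : ∀ {n} (a : Vec Tri n) → Any (_≡ m1) a → HasNegEdge (T a)
T-HasNegEdge {n} a any = fzero , fsuc i , edge
  where
  i = index any
  edge : T a fzero (fsuc i) ≡ neg
  edge rewrite T-unfold a fzero (fsuc i) | ⌊⌋-true (fzero {n} <ᶠ? fsuc i) (s≤s z≤n) | lookup-index any = refl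

T-¬HasNegEdge : ∀ {n} (a : Vec Tri n) → All (_≢ m1) a → ¬ HasNegEdge (T a)
T-¬HasNegEdge a unsigned (u , v , uv-neg) =
  edgeBetween-neg ⌊ u <ᶠ? v ⌋ ⌊ v <ᶠ? u ⌋ (trans (sym (T-unfold a u v)) uv-neg)
  where
  laterEdge-neg : ∀ w → laterEdge a w ≢ neg
  laterEdge-neg (fsuc i) eq with lookup a i | lookup⁺ unsigned i
  ... | m1 | m1≢m1 = m1≢m1 refl
  edgeBetween-neg : ∀ b₁ b₂ → edgeBetween b₁ b₂ (laterEdge a v) (laterEdge a u) ≢ neg
  edgeBetween-neg true  _     = laterEdge-neg v
  edgeBetween-neg false true  = laterEdge-neg u
  edgeBetween-neg false false ()

unsigned-≅ : ∀ {n} {a b : Vec Tri n} → T a ≅ T b → All (_≢ m1) a → All (_≢ m1) b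
unsigned-≅ {b = b} iso a-unsigned with m1-or-none b
... | inj₂ none = none
... | inj₁ any  = contradiction (HasNegEdge-≅ (≅-sym iso) (T-HasNegEdge b any)) (T-¬HasNegEdge _ a-unsigned)

isPos : Edge → Bool
isPos noEdge = false
isPos pos    = true
isPos neg    = false

isPos-triEdge : ∀ x → isPos (triEdge x) ≡ isP1 x
isPos-triEdge m1 = refl
isPos-triEdge z  = refl
isPos-triEdge p1 = refl

posDegree : ∀ {m} → SignedGraph m → Fin m → ℕ
posDegree G v = sum λ w → 𝟙 (isPos (G v w))

degreeCount : ∀ {m} → SignedGraph m → ℕ → ℕ
degreeCount G d = sum λ v → 𝟙 ⌊ posDegree G v ℕ.≟ d ⌋

degreeCount-≅ : ∀ {m m′} {G₁ : SignedGraph m} {G₂ : SignedGraph m′} → G₁ ≅ G₂ →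
                ∀ d → degreeCount G₂ d ≡ degreeCount G₁ d
degreeCount-≅ {G₁ = G₁} {G₂} iso d =
  trans (sum-⤖ φ _) (sum-cong-≗ λ v → cong (λ k → 𝟙 ⌊ k ℕ.≟ d ⌋) (same-degree v))
  where
  open _≅_ iso
  same-degree : ∀ v → posDegree G₂ (Bijection.to φ v) ≡ posDegree G₁ v
  same-degree v = trans (sum-⤖ φ _) (sum-cong-≗ λ w → cong (𝟙 ∘ isPos) (preserve v w))

module _ {n : ℕ} (a : Vec Tri n) (x : Tri) where

  posDegree-T-∷ʳ-old : ∀ u → posDegree (T (a ∷ʳ x)) (inject₁ u) ≡ posDegree (T a) u + 𝟙 (isP1 x)
  posDegree-T-∷ʳ-old u = trans (sum-init-last (λ w → 𝟙 (isPos (T (a ∷ʳ x) (inject₁ u) w)))) (cong₂ _+_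
    (sum-cong-≗ λ w → cong (𝟙 ∘ isPos) (T-∷ʳ-old a x u w))
    (cong 𝟙 (trans (cong isPos (T-∷ʳ-old-new a x u)) (isPos-triEdge x))))

  posDegree-T-∷ʳ-new : posDegree (T (a ∷ʳ x)) (fromℕ (suc n)) ≡ suc n * 𝟙 (isP1 x)
  posDegree-T-∷ʳ-new = begin
      posDegree (T (a ∷ʳ x)) new
    ≡⟨ sum-init-last (λ w → 𝟙 (isPos (T (a ∷ʳ x) new w))) ⟩
      sum (λ u → 𝟙 (isPos (T (a ∷ʳ x) new (inject₁ u)))) + 𝟙 (isPos (T (a ∷ʳ x) new new))
    ≡⟨ cong₂ _+_ (sum-cong-≗ λ u → cong 𝟙 (trans (cong isPos (T-∷ʳ-new-old a x u)) (isPos-triEdge x)))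
                 (cong (𝟙 ∘ isPos) (T-loop (a ∷ʳ x) new)) ⟩
      sum {suc n} (λ _ → 𝟙 (isP1 x)) + 0
    ≡⟨ trans (ℕ.+-identityʳ _) (sum-const {suc n} (𝟙 (isP1 x))) ⟩
      suc n * 𝟙 (isP1 x)
    ∎
    where
    open ≡-Reasoning
    new = fromℕ (suc n)

  degreeCount-T-∷ʳ : ∀ d → degreeCount (T (a ∷ʳ x)) d
                           ≡ sum (λ u → 𝟙 ⌊ posDegree (T a) u + 𝟙 (isP1 x) ℕ.≟ d ⌋)
                             + 𝟙 ⌊ suc n * 𝟙 (isP1 x) ℕ.≟ d ⌋
  degreeCount-T-∷ʳ d = trans (sum-init-last (λ v → 𝟙 ⌊ posDegree (T (a ∷ʳ x)) v ℕ.≟ d ⌋)) (cong₂ _+_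
    (sum-cong-≗ λ u → cong (λ k → 𝟙 ⌊ k ℕ.≟ d ⌋) (posDegree-T-∷ʳ-old u))
    (cong (λ k → 𝟙 ⌊ k ℕ.≟ d ⌋) posDegree-T-∷ʳ-new))

𝟙≤1 : ∀ b → 𝟙 b ≤ 1
𝟙≤1 true  = ℕ.≤-refl
𝟙≤1 false = z≤n

posDegree-T-≤ : ∀ {n} (a : Vec Tri n) v → posDegree (T a) v ≤ n
posDegree-T-≤ = ∷ʳ-induction (λ {n} a → ∀ v → posDegree (T a) v ≤ n) (λ { fzero → z≤n }) step
  where
  step : ∀ {n} (a : Vec Tri n) x → (∀ v → posDegree (T a) v ≤ n) → ∀ v → posDegree (T (a ∷ʳ x)) v ≤ suc n
  step {n} a x IH v with inject₁-or-last v
  ... | inj₁ (u , refl) rewrite posDegree-T-∷ʳ-old a x u =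
    ℕ.≤-trans (ℕ.+-mono-≤ (IH u) (𝟙≤1 (isP1 x))) (ℕ.≤-reflexive (ℕ.+-comm n 1))
  ... | inj₂ refl rewrite posDegree-T-∷ʳ-new a x =
    ℕ.≤-trans (ℕ.*-monoʳ-≤ (suc n) (𝟙≤1 (isP1 x))) (ℕ.≤-reflexive (ℕ.*-identityʳ (suc n)))

module _ {n : ℕ} (a : Vec Tri n) (x : Tri) where

  degreeCount-T-∷ʳ-isolated : isP1 x ≡ false → ∀ d →
                              degreeCount (T (a ∷ʳ x)) d ≡ degreeCount (T a) d + 𝟙 ⌊ 0 ℕ.≟ d ⌋
  degreeCount-T-∷ʳ-isolated x-isolated d rewrite degreeCount-T-∷ʳ a x d | x-isolated | ℕ.*-zeroʳ n =
    cong (_+ 𝟙 ⌊ 0 ℕ.≟ d ⌋) (sum-cong-≗ λ u → cong (λ k → 𝟙 ⌊ k ℕ.≟ d ⌋) (ℕ.+-identityʳ (posDegree (T a) u)))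

  degreeCount-T-∷ʳ-cone : isP1 x ≡ true → ∀ d →
                          degreeCount (T (a ∷ʳ x)) (suc d) ≡ degreeCount (T a) d + 𝟙 ⌊ suc n ℕ.≟ suc d ⌋
  degreeCount-T-∷ʳ-cone x-cone d rewrite degreeCount-T-∷ʳ a x (suc d) | x-cone | ℕ.*-identityʳ n =
    cong (_+ 𝟙 ⌊ suc n ℕ.≟ suc d ⌋) (sum-cong-≗ λ u →
      trans (cong (λ k → 𝟙 ⌊ k ℕ.≟ suc d ⌋) (ℕ.+-comm (posDegree (T a) u) 1))
            (cong 𝟙 (⌊⌋-⇔ (mk⇔ ℕ.suc-injective (cong suc)) (suc _ ℕ.≟ suc d) (_ ℕ.≟ d))))

  -- Only a cone vertex added last reaches the maximal positive degree n + 1.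
  degreeCount-T-∷ʳ-top-isolated : isP1 x ≡ false → degreeCount (T (a ∷ʳ x)) (suc n) ≡ 0
  degreeCount-T-∷ʳ-top-isolated x-isolated rewrite degreeCount-T-∷ʳ-isolated x-isolated (suc n) =
    trans (ℕ.+-identityʳ _) (trans (sum-cong-≗ below-top) (trans (sum-const {suc n} 0) (ℕ.*-zeroʳ (suc n))))
    where
    below-top : ∀ u → 𝟙 ⌊ posDegree (T a) u ℕ.≟ suc n ⌋ ≡ 0
    below-top u rewrite ⌊⌋-false (posDegree (T a) u ℕ.≟ suc n) (λ eq → ℕ.<-irrefl eq (s≤s (posDegree-T-≤ a u))) = refl

  degreeCount-T-∷ʳ-top-cone : isP1 x ≡ true → 1 ≤ degreeCount (T (a ∷ʳ x)) (suc n)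
  degreeCount-T-∷ʳ-top-cone x-cone rewrite degreeCount-T-∷ʳ a x (suc n) | x-cone | ℕ.*-identityʳ n
    | ⌊⌋-true (suc n ℕ.≟ suc n) refl = ℕ.m≤n+m 1 _

degreeCount-T-injective : ∀ {n} (a b : Vec Tri n) → (∀ d → degreeCount (T a) d ≡ degreeCount (T b) d) →
                          positivePattern a ≡ positivePattern b
degreeCount-T-injective = ∷ʳ-induction Injective (λ { [] _ → refl }) step
  where
  Injective : ∀ {n} → Vec Tri n → Set
  Injective {n} a = ∀ (b : Vec Tri n) → (∀ d → degreeCount (T a) d ≡ degreeCount (T b) d) →
                    positivePattern a ≡ positivePattern b
  step : ∀ {n} (a : Vec Tri n) x → Injective a → Injective (a ∷ʳ x)
  step {n} a x IH b same with initLast b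
  ... | b′ , y , refl =
    trans (map-∷ʳ isP1 x a) (trans (last-step (isP1 x) (isP1 y) refl refl) (sym (map-∷ʳ isP1 y b′)))
    where
    last-step : ∀ bx by → isP1 x ≡ bx → isP1 y ≡ by → positivePattern a ∷ʳ isP1 x ≡ positivePattern b′ ∷ʳ isP1 y
    last-step false false x≡ y≡ = cong₂ _∷ʳ_
      (IH b′ λ d → ℕ.+-cancelʳ-≡ _ _ _ (trans (sym (degreeCount-T-∷ʳ-isolated a x x≡ d))
                                           (trans (same d) (degreeCount-T-∷ʳ-isolated b′ y y≡ d))))
      (trans x≡ (sym y≡))
    last-step true  true  x≡ y≡ = cong₂ _∷ʳ_
      (IH b′ λ d → ℕ.+-cancelʳ-≡ _ _ _ (trans (sym (degreeCount-T-∷ʳ-cone a x x≡ d))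
                                           (trans (same (suc d)) (degreeCount-T-∷ʳ-cone b′ y y≡ d))))
      (trans x≡ (sym y≡))
    last-step false true  x≡ y≡ = contradiction (trans (sym (same (suc n))) (degreeCount-T-∷ʳ-top-isolated a x x≡))
                                                (ℕ.>⇒≢ (degreeCount-T-∷ʳ-top-cone b′ y y≡))
    last-step true  false x≡ y≡ = contradiction (trans (same (suc n)) (degreeCount-T-∷ʳ-top-isolated b′ y y≡))
                                                (ℕ.>⇒≢ (degreeCount-T-∷ʳ-top-cone a x x≡))

≅⇒≡ : ∀ {n} {a b : Vec Tri n} → Admissible a → Admissible b → T a ≅ T b → a ≡ b
≅⇒≡ {a = a} {b} adm-a adm-b iso = admissible-injective adm-a adm-b
  (degreeCount-T-injective a b (λ d → sym (degreeCount-≅ iso d)))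
  (unsigned-≅ iso) (unsigned-≅ (≅-sym iso))

-- E and O

-- On each line y = 1 + μ the points x = 1 + μ + r + 2t, with λ − μ ≡ r (mod 2), are unbounded.
parity-unique : ∀ r → r < 2 → ∀ p q →
                (∀ l μ → μ ≤ l → (l ∸ μ) % 2 ≡ r → eval p (+ l) (+ μ) ≡ eval q (+ l) (+ μ)) → p ≐ q
parity-unique r r<2 p q agree = eval-injective point t<point p q λ μ t →
  agree (point μ t) (suc μ) (ℕ.m≤m+n (suc μ) _) (parity μ t)
  where
  point : ℕ → ℕ → ℕ
  point μ t = suc μ + (r + t * 2)
  t<point : ∀ μ t → t < point μ t
  t<point μ t = s≤s (ℕ.≤-trans (ℕ.m≤m*n t 2) (ℕ.≤-trans (ℕ.m≤n+m (t * 2) r) (ℕ.m≤n+m _ μ)))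
  parity : ∀ μ t → (point μ t ∸ suc μ) % 2 ≡ r
  parity μ t = trans (cong (_% 2) (ℕ.m+n∸m≡n (suc μ) (r + t * 2))) (trans ([m+kn]%n≡m%n r t 2) (m<n⇒m%n≡m r<2))

IsE-unique : ∀ {m} (G : SignedGraph m) p q → IsE G p → IsE G q → p ≐ q
IsE-unique G p q Ep Eq =
  parity-unique 0 (s≤s z≤n) p q λ l μ μ≤l even → trans (Ep l μ μ≤l even) (sym (Eq l μ μ≤l even))

IsO-unique : ∀ {m} (G : SignedGraph m) p q → IsO G p → IsO G q → p ≐ q
IsO-unique G p q Op Oq =
  parity-unique 1 ℕ.≤-refl p q λ l μ μ≤l odd → trans (Op l μ μ≤l odd) (sym (Oq l μ μ≤l odd))

E-injective : ∀ {n} {a b : Vec Tri n} → Admissible a → Admissible b → ∀ Ea Eb →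
              IsE (T a) Ea → IsE (T b) Eb → Ea ≐ Eb → a ≡ b
E-injective {a = a} {b} adm-a adm-b Ea Eb Ea-is Eb-is Ea≐Eb = colourings-injective adm-a adm-b same
  where
  same : SameEvenColourings a b
  same l μ μ≤l even = +-injective (begin
      + colourings a l μ    ≡⟨ cong +_ (f-T≡colourings l μ μ≤l even a) ⟨
      + f (T a) l μ         ≡⟨ Ea-is l μ μ≤l even ⟨
      eval Ea (+ l) (+ μ)   ≡⟨ eval-cong Ea Eb Ea≐Eb (+ l) (+ μ) ⟩
      eval Eb (+ l) (+ μ)   ≡⟨ Eb-is l μ μ≤l even ⟩
      + f (T b) l μ         ≡⟨ cong +_ (f-T≡colourings l μ μ≤l even b) ⟩
      + colourings b l μ    ∎)
    where open ≡-Reasoning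

theorem4p14 : (n : ℕ) (a b : Vec Tri n) → Admissible a → Admissible b →
    (Ea Eb Oa Ob : Poly) → IsE (T a) Ea → IsE (T b) Eb → IsO (T a) Oa → IsO (T b) Ob →
    ((a ≡ b) ⇔ (T a ≅ T b)) × ((T a ≅ T b) ⇔ ((Ea ≐ Eb) × (Oa ≐ Ob))) × (((Ea ≐ Eb) × (Oa ≐ Ob)) ⇔ (Ea ≐ Eb))
theorem4p14 n a b adm-a adm-b Ea Eb Oa Ob Ea-is Eb-is Oa-is Ob-is =
    mk⇔ ≡⇒≅ (≅⇒≡ adm-a adm-b)
  , mk⇔ (≡⇒same-polynomials ∘ ≅⇒≡ adm-a adm-b) (≡⇒≅ ∘ E⇒≡ ∘ proj₁)
  , mk⇔ proj₁ (≡⇒same-polynomials ∘ E⇒≡)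
  where
  ≡⇒≅ : a ≡ b → T a ≅ T b
  ≡⇒≅ refl = record { φ = ⤖-id _ ; preserve = λ u v → refl }
  ≡⇒same-polynomials : a ≡ b → (Ea ≐ Eb) × (Oa ≐ Ob)
  ≡⇒same-polynomials refl = IsE-unique (T a) Ea Eb Ea-is Eb-is , IsO-unique (T a) Oa Ob Oa-is Ob-is
  E⇒≡ : Ea ≐ Eb → a ≡ b
  E⇒≡ = E-injective adm-a adm-b Ea Eb Ea-is Eb-is
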